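{- Let $\mathcal I$ be the set of involutions (permutations $\pi$ with $\pi=\pi^{ -1}$) of all lengths $n\ge0$. Then $$\sum_{\pi\in\mathcal I} x^{\mathrm{fp}(\pi)}v^{\mathrm{exc}(\pi)}t^{\mathrm{cyc}(\pi)}q^{\mathrm{inv}(\pi)}z^{|\pi|}=J_{\mathbf d,\boldsymbol\ell}(z),$$ with $d_h=vtq^{2h-1}[h]_{q^2}$ for $h\ge1$ and $\ell_h=xtq^{2h}$ for $h\ge0$, where $[h]_{q^2}=1+q^2+q^4+\dots+q^{2(h-1)}$.
   Context: $\mathrm{fp},\mathrm{exc},\mathrm{cyc},\mathrm{inv}$ are the numbers of fixed points, of $i$ with $\pi(i)>i$, of cycles, and of inversions of $\pi$; $|\pi|=n$ for $\pi\in\mathfrak S_n$. $J_{\mathbf d,\boldsymbol\ell}(z)=1/(1-\ell_0z-d_1z^2/(1-\ell_1z-d_2z^2/(1-\ell_2z-\cdots)))$. -}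

module Defs where

open import Algebra.Bundles using (CommutativeRing)
open import Data.Nat as ℕ using (ℕ; zero; suc; _∸_; _<ᵇ_; _≤ᵇ_)
open import Data.Fin as Fin using (Fin; toℕ)
open import Data.Fin.Properties using (_≟_)
open import Data.Vec as Vec using (Vec; lookup)
open import Data.List as List using (List; concatMap; allFin; upTo)
open import Data.Nat.ListAction using (sum)
open import Data.Bool using (Bool; true; false; if_then_else_; _∧_)
open import Relation.Nullary.Decidable using (⌊_⌋)

all : ∀ {a} {A : Set a} → (A → Bool) → List A → Bool
all p = List.foldr (λ a b → p a ∧ b) true

allVecs : (n m : ℕ) → List (Vec (Fin n) m)
allVecs n zero = Vec.[] List.∷ List.[]
allVecs n (suc m) = concatMap (λ i → List.map (i Vec.∷_) (allVecs n m)) (allFin n)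

allMaps : (n : ℕ) → List (Vec (Fin n) n)
allMaps n = allVecs n n

app : ∀ {n} → Vec (Fin n) n → Fin n → Fin n
app π i = lookup π i

-- π is an involution: π ∘ π = id (hence π is a permutation with π = π⁻¹)
isInvolution : ∀ {n} → Vec (Fin n) n → Bool
isInvolution {n} π = all (λ i → ⌊ app π (app π i) ≟ i ⌋) (allFin n)

count : ∀ {n} → (Fin n → Bool) → ℕ
count {n} p = List.foldr (λ i acc → if p i then suc acc else acc) 0 (allFin n)

iter : ∀ {n} → Vec (Fin n) n → ℕ → Fin n → Fin n
iter π zero i = i
iter π (suc k) i = app π (iter π k i)

fp : ∀ {n} → Vec (Fin n) n → ℕ
fp π = count (λ i → ⌊ app π i ≟ i ⌋)

exc : ∀ {n} → Vec (Fin n) n → ℕ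
exc π = count (λ i → toℕ i <ᵇ toℕ (app π i))

-- cycles: counted via their minimal elements; i is the minimum of its
-- cycle iff π^k(i) ≥ i for all k < n
cyc : ∀ {n} → Vec (Fin n) n → ℕ
cyc {n} π = count (λ i → all (λ k → toℕ i ≤ᵇ toℕ (iter π k i)) (upTo n))

inv : ∀ {n} → Vec (Fin n) n → ℕ
inv {n} π = sum (List.map (λ i → count (λ j →
              (toℕ i <ᵇ toℕ j) ∧ (toℕ (app π j) <ᵇ toℕ (app π i)))) (allFin n))

module _ {c ℓ} (R : CommutativeRing c ℓ) where
  open CommutativeRing R

  pow : Carrier → ℕ → Carrier
  pow a zero = 1#
  pow a (suc k) = a * pow a k

  sumTo : (ℕ → Carrier) → ℕ → Carrier
  sumTo f zero = 0#
  sumTo f (suc n) = sumTo f n + f n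

  PS : Set c
  PS = ℕ → Carrier

  onePS : PS
  onePS zero = 1#
  onePS (suc n) = 0#

  mulPS : PS → PS → PS
  mulPS f g n = sumTo (λ i → f i * g (n ∸ i)) (suc n)

  powPS : PS → ℕ → PS
  powPS A zero = onePS
  powPS A (suc k) = mulPS A (powPS A k)

  -- 1/(1 - A) = Σ_k A^k, for A with zero constant term
  -- (A^k has no terms below z^k, so the sum is finite coefficientwise)
  geom : PS → PS
  geom A n = sumTo (λ k → powPS A k n) (suc n)

  lin : Carrier → Carrier → PS → PS
  lin a b F zero = 0#
  lin a b F (suc zero) = a
  lin a b F (suc (suc n)) = b * F n

  -- truncated J-fraction starting at level h, with m further levels:
  --   cf d l 0 h       = 1/(1 - l_h z)
  --   cf d l (m+1) h   = 1/(1 - l_h z - d_{h+1} z² · cf d l m (h+1))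
  cf : (d l : ℕ → Carrier) → ℕ → ℕ → PS
  cf d l zero h = geom (lin (l h) 0# (λ _ → 0#))
  cf d l (suc m) h = geom (lin (l h) (d (suc h)) (cf d l m (suc h)))


  qint : Carrier → ℕ → Carrier
  qint q h = sumTo (λ i → pow q (2 ℕ.* i)) h

  dSeq : (v t q : Carrier) → ℕ → Carrier
  dSeq v t q h = v * t * pow q (2 ℕ.* h ∸ 1) * qint q h

  lSeq : (x t q : Carrier) → ℕ → Carrier
  lSeq x t q h = x * t * pow q (2 ℕ.* h)

  involGF : (x v t q : Carrier) → ℕ → Carrier
  involGF x v t q n = List.foldr _+_ 0#
    (List.map (λ π → if isInvolution π
                       then pow x (fp π) * pow v (exc π) * pow t (cyc π) * pow q (inv π)
                       else 0#)
              (allMaps n))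

module Submission where

-- Read an involution from left to right as a weighted Motzkin path: a fixed point is a
-- level step, the smaller point of a 2-cycle a rise and the larger one a fall, so the
-- height at a point is the number of arcs passing over it.  Let involSum N h sum the
-- weights of the involutions of N points whose first h points all open arcs.  Removing
-- the point h shows that involSum obeys the path recursion: a fixed point under h arcs
-- costs x t q^{2h} = ℓ_h, an opener raises the height, and closing the arc opened at
-- a < h costs v t q^{2h-1} q^{2a}, which summed over a is d_h.  On the other side,
-- decomposing a path at its last visits to each lower height expresses the same path
-- sums as the coefficients of the truncated J-fraction.

open import Defs
open import Algebra.Bundles using (CommutativeRing)
open import Data.Nat as ℕ using (ℕ; zero; suc; _∸_; _≤_; _<_; z≤n; s≤s; _<ᵇ_; _≤ᵇ_)
import Data.Nat.Properties as ℕₚ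
open import Data.Fin as Fin using (Fin; toℕ; fromℕ<; punchIn; punchOut)
open import Data.Fin.Properties using (_≟_; toℕ-injective; toℕ<n; toℕ-fromℕ<; suc-injective; 0≢1+n;
  punchInᵢ≢i; punchIn-injective; punchIn-punchOut; punchOut-punchIn; punchOut-cong)
open import Data.Fin.Permutation using (permutation)
open import Data.Vec as Vec using (Vec; []; _∷_; tabulate)
open import Data.Vec.Properties using (lookup∘tabulate; tabulate∘lookup; tabulate-cong)
open import Data.List as List using (List; concatMap; allFin)
open import Data.Bool using (Bool; true; false; if_then_else_; _∧_; T)
open import Data.Bool.Properties using (∧-zeroʳ; ∧-identityʳ)
open import Data.Unit using (tt)
open import Data.Empty using (⊥-elim)
open import Data.Product using (_×_; _,_; proj₁; proj₂; Σ-syntax)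
open import Data.Sum using (_⊎_; inj₁; inj₂)
open import Relation.Nullary using (¬_; Dec; yes; no)
open import Relation.Nullary.Decidable using (⌊_⌋)
open import Relation.Binary using (tri<; tri≈; tri>)
open import Relation.Binary.PropositionalEquality as ≡ using (_≡_; _≢_; cong; cong₂)
open import Function using (_∘_; id)
open import Algebra.Properties.CommutativeMonoid.Sum ℕₚ.+-0-commutativeMonoid
  using (sum-remove; sum-permute; sum-cong-≗; ∑-distrib-+) renaming (sum to ∑)

private
  T⇒≡true : ∀ {b} → T b → b ≡ true
  T⇒≡true {true} _ = ≡.refl

  ≡true⇒T : ∀ {b} → b ≡ true → T b
  ≡true⇒T ≡.refl = tt

  ¬T⇒≡false : ∀ {b} → ¬ T b → b ≡ false
  ¬T⇒≡false {false} _ = ≡.refl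
  ¬T⇒≡false {true} ¬t = ⊥-elim (¬t tt)

<ᵇ-true : ∀ {m n} → m < n → (m <ᵇ n) ≡ true
<ᵇ-true m<n = T⇒≡true (ℕₚ.<⇒<ᵇ m<n)

<ᵇ-false : ∀ {m n} → n ≤ m → (m <ᵇ n) ≡ false
<ᵇ-false {m} {n} n≤m = ¬T⇒≡false (λ t → ℕₚ.<⇒≱ (ℕₚ.<ᵇ⇒< m n t) n≤m)

<ᵇ-true⁻¹ : ∀ {m n} → (m <ᵇ n) ≡ true → m < n
<ᵇ-true⁻¹ {m} {n} e = ℕₚ.<ᵇ⇒< m n (≡true⇒T e)

<ᵇ-irrefl : ∀ m → (m <ᵇ m) ≡ false
<ᵇ-irrefl m = <ᵇ-false (ℕₚ.≤-refl {m})

≤ᵇ-true : ∀ {m n} → m ≤ n → (m ≤ᵇ n) ≡ true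
≤ᵇ-true m≤n = T⇒≡true (ℕₚ.≤⇒≤ᵇ m≤n)

≤ᵇ-false : ∀ {m n} → n < m → (m ≤ᵇ n) ≡ false
≤ᵇ-false {m} {n} n<m = ¬T⇒≡false (λ t → ℕₚ.<⇒≱ n<m (ℕₚ.≤ᵇ⇒≤ m n t))

≤ᵇ-refl : ∀ m → (m ≤ᵇ m) ≡ true
≤ᵇ-refl m = ≤ᵇ-true (ℕₚ.≤-refl {m})

⌊⌋-true : ∀ {p} {P : Set p} (P? : Dec P) → P → ⌊ P? ⌋ ≡ true
⌊⌋-true (yes _) _ = ≡.refl
⌊⌋-true (no ¬p) p = ⊥-elim (¬p p)

⌊⌋-false : ∀ {p} {P : Set p} (P? : Dec P) → ¬ P → ⌊ P? ⌋ ≡ false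
⌊⌋-false (yes p) ¬p = ⊥-elim (¬p p)
⌊⌋-false (no _) _ = ≡.refl

⌊⌋-true⁻¹ : ∀ {p} {P : Set p} (P? : Dec P) → ⌊ P? ⌋ ≡ true → P
⌊⌋-true⁻¹ (yes p) _ = p

∧-true⁻¹ : ∀ {a b} → (a ∧ b) ≡ true → a ≡ true × b ≡ true
∧-true⁻¹ {true} {true} _ = ≡.refl , ≡.refl

module FiniteSums {c ℓ} (R : CommutativeRing c ℓ) where
  open CommutativeRing R hiding (zero)
  open import Relation.Binary.Reasoning.Setoid setoid
  open import Algebra.Properties.CommutativeSemigroup +-commutativeSemigroup using (interchange)

  private
    Σ : (ℕ → Carrier) → ℕ → Carrier
    Σ = sumTo R

  sumTo-cong< : ∀ {f g : ℕ → Carrier} n → (∀ i → i < n → f i ≈ g i) → Σ f n ≈ Σ g n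
  sumTo-cong< zero eq = refl
  sumTo-cong< (suc n) eq = +-cong (sumTo-cong< n (λ i i<n → eq i (ℕₚ.m<n⇒m<1+n i<n))) (eq n ℕₚ.≤-refl)

  sumTo-cong : ∀ {f g : ℕ → Carrier} n → (∀ i → f i ≈ g i) → Σ f n ≈ Σ g n
  sumTo-cong n eq = sumTo-cong< n (λ i _ → eq i)

  sumTo-zero : ∀ {f : ℕ → Carrier} n → (∀ i → i < n → f i ≈ 0#) → Σ f n ≈ 0#
  sumTo-zero zero eq = refl
  sumTo-zero (suc n) eq =
    trans (+-cong (sumTo-zero n (λ i i<n → eq i (ℕₚ.m<n⇒m<1+n i<n))) (eq n ℕₚ.≤-refl)) (+-identityˡ 0#)

  sumTo-distrib-+ : ∀ (f g : ℕ → Carrier) n → Σ (λ i → f i + g i) n ≈ Σ f n + Σ g n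
  sumTo-distrib-+ f g zero = sym (+-identityˡ 0#)
  sumTo-distrib-+ f g (suc n) = trans (+-congʳ (sumTo-distrib-+ f g n)) (interchange _ _ _ _)

  *-distribˡ-sumTo : ∀ a (f : ℕ → Carrier) n → a * Σ f n ≈ Σ (λ i → a * f i) n
  *-distribˡ-sumTo a f zero = zeroʳ a
  *-distribˡ-sumTo a f (suc n) = trans (distribˡ a _ _) (+-congʳ (*-distribˡ-sumTo a f n))

  *-distribʳ-sumTo : ∀ a (f : ℕ → Carrier) n → Σ f n * a ≈ Σ (λ i → f i * a) n
  *-distribʳ-sumTo a f zero = zeroˡ a
  *-distribʳ-sumTo a f (suc n) = trans (distribʳ a _ _) (+-congʳ (*-distribʳ-sumTo a f n))

  sumTo-suc : ∀ (f : ℕ → Carrier) n → Σ f (suc n) ≈ f 0 + Σ (f ∘ suc) n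
  sumTo-suc f zero = trans (+-identityˡ _) (sym (+-identityʳ _))
  sumTo-suc f (suc n) = trans (+-congʳ (sumTo-suc f n)) (+-assoc _ _ _)

  sumTo-comm : ∀ (f : ℕ → ℕ → Carrier) a b → Σ (λ i → Σ (f i) b) a ≈ Σ (λ j → Σ (λ i → f i j) a) b
  sumTo-comm f zero b = sym (sumTo-zero b (λ _ _ → refl))
  sumTo-comm f (suc a) b = begin
    Σ (λ i → Σ (f i) b) a + Σ (f a) b         ≈⟨ +-congʳ (sumTo-comm f a b) ⟩
    Σ (λ j → Σ (λ i → f i j) a) b + Σ (f a) b ≈⟨ sumTo-distrib-+ _ _ b ⟨
    Σ (λ j → Σ (λ i → f i j) (suc a)) b       ∎

  sumTo-extend : ∀ (f : ℕ → Carrier) j n → j ≤ n → (∀ i → j ≤ i → i < n → f i ≈ 0#) → Σ f n ≈ Σ f j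
  sumTo-extend f j zero z≤n vanish = refl
  sumTo-extend f j (suc n) j≤1+n vanish with ℕₚ.m≤n⇒m<n∨m≡n j≤1+n
  ... | inj₂ ≡.refl = refl
  ... | inj₁ j≤n = trans (+-cong (sumTo-extend f j n (ℕₚ.m<1+n⇒m≤n j≤n)
                                    (λ i j≤i i<n → vanish i j≤i (ℕₚ.m<n⇒m<1+n i<n)))
                                 (vanish n (ℕₚ.m<1+n⇒m≤n j≤n) ℕₚ.≤-refl))
                         (+-identityʳ _)

  sumTo-reverse : ∀ (f : ℕ → Carrier) n → Σ f (suc n) ≈ Σ (λ i → f (n ∸ i)) (suc n)
  sumTo-reverse f zero = refl
  sumTo-reverse f (suc n) = begin
    Σ f (suc n) + f (suc n)                   ≈⟨ +-congʳ (sumTo-reverse f n) ⟩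
    Σ (λ i → f (n ∸ i)) (suc n) + f (suc n)   ≈⟨ +-comm _ _ ⟩
    f (suc n) + Σ (λ i → f (n ∸ i)) (suc n)   ≈⟨ sumTo-suc (λ i → f (suc n ∸ i)) (suc n) ⟨
    Σ (λ i → f (suc n ∸ i)) (suc (suc n))     ∎

  sumTo-triangle : ∀ (g : ℕ → ℕ → Carrier) n →
    Σ (λ k → Σ (λ i → g i k) (suc k)) (suc n) ≈ Σ (λ i → Σ (λ k → g i (i ℕ.+ k)) (suc (n ∸ i))) (suc n)
  sumTo-triangle g zero = refl
  sumTo-triangle g (suc n) = begin
    Σ (λ k → Σ (λ i → g i k) (suc k)) (suc n) + Σ (λ i → g i (suc n)) (suc (suc n))
      ≈⟨ +-congʳ (sumTo-triangle g n) ⟩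
    Σ row (suc n) + (Σ (λ i → g i (suc n)) (suc n) + g (suc n) (suc n))
      ≈⟨ +-assoc _ _ _ ⟨
    (Σ row (suc n) + Σ (λ i → g i (suc n)) (suc n)) + g (suc n) (suc n)
      ≈⟨ +-cong (sumTo-distrib-+ _ _ (suc n)) (reflexive (cong (g (suc n)) (ℕₚ.+-identityʳ (suc n)))) ⟨
    Σ (λ i → row i + g i (suc n)) (suc n) + g (suc n) (suc n ℕ.+ 0)
      ≈⟨ +-congʳ (sumTo-cong< (suc n) λ i i<1+n → reflexive (row-extend i (ℕₚ.m<1+n⇒m≤n i<1+n))) ⟩
    Σ row′ (suc n) + g (suc n) (suc n ℕ.+ 0)
      ≈⟨ +-congˡ (trans (sym (+-identityˡ _)) (reflexive (cong (λ k → Σ (λ k′ → g (suc n) (suc n ℕ.+ k′)) (suc k))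
                                                           (≡.sym (ℕₚ.n∸n≡0 n))))) ⟩
    Σ row′ (suc (suc n)) ∎
    where
    row row′ : ℕ → Carrier
    row i = Σ (λ k → g i (i ℕ.+ k)) (suc (n ∸ i))
    row′ i = Σ (λ k → g i (i ℕ.+ k)) (suc (suc n ∸ i))
    row-extend : ∀ i → i ≤ n → row i + g i (suc n) ≡ row′ i
    row-extend i i≤n rewrite ℕₚ.+-∸-assoc 1 i≤n =
      cong (λ k → row i + g i k) (≡.sym (≡.trans (ℕₚ.+-suc i (n ∸ i)) (cong suc (ℕₚ.m+[n∸m]≡n i≤n))))

  sumTo-δ : ∀ (w : Carrier) y n → y < n → Σ (λ a → if ⌊ y ℕₚ.≟ a ⌋ then w else 0#) n ≈ w
  sumTo-δ w y (suc n) y<1+n with ℕₚ.m<1+n⇒m<n∨m≡n y<1+n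
  ... | inj₂ ≡.refl = trans (+-cong (sumTo-zero n (λ a a<n → reflexive (cong (λ b → if b then w else 0#)
                                       (⌊⌋-false (y ℕₚ.≟ a) (λ y≡a → ℕₚ.<-irrefl (≡.sym y≡a) a<n)))))
                                    (reflexive (cong (λ b → if b then w else 0#) (⌊⌋-true (y ℕₚ.≟ y) ≡.refl))))
                            (+-identityˡ w)
  ... | inj₁ y<n = trans (+-cong (sumTo-δ w y n y<n) (reflexive (cong (λ b → if b then w else 0#)
                                    (⌊⌋-false (y ℕₚ.≟ n) (λ y≡n → ℕₚ.<-irrefl y≡n y<n)))))
                         (+-identityʳ w)

  sumTo-δ-zero : ∀ (w : Carrier) y n → n ≤ y → Σ (λ a → if ⌊ y ℕₚ.≟ a ⌋ then w else 0#) n ≈ 0#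
  sumTo-δ-zero w y n n≤y = sumTo-zero n λ a a<n → reflexive (cong (λ b → if b then w else 0#)
    (⌊⌋-false (y ℕₚ.≟ a) (λ y≡a → ℕₚ.<-irrefl (≡.sym y≡a) (ℕₚ.<-≤-trans a<n n≤y))))

module PowerSeries {c ℓ} (R : CommutativeRing c ℓ) where
  open CommutativeRing R hiding (zero)
  open import Relation.Binary.Reasoning.Setoid setoid
  open FiniteSums R

  infix 4 _≈ₚ_
  infixl 6 _⊕_
  infixl 7 _⊙_

  _≈ₚ_ : PS R → PS R → Set ℓ
  A ≈ₚ B = ∀ n → A n ≈ B n

  _⊕_ : PS R → PS R → PS R
  (A ⊕ B) n = A n + B n

  _⊙_ : Carrier → PS R → PS R
  (a ⊙ A) n = a * A n

  shift : PS R → PS R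
  shift A zero = 0#
  shift A (suc n) = A n

  private
    _·_ : PS R → PS R → PS R
    _·_ = mulPS R
    infixl 7 _·_

  mulPS-cong : ∀ {A A′ B B′} → A ≈ₚ A′ → B ≈ₚ B′ → A · B ≈ₚ A′ · B′
  mulPS-cong A≈ B≈ n = sumTo-cong (suc n) (λ i → *-cong (A≈ i) (B≈ (n ∸ i)))

  mulPS-distribʳ : ∀ A B C → (A ⊕ B) · C ≈ₚ A · C ⊕ B · C
  mulPS-distribʳ A B C n = trans (sumTo-cong (suc n) (λ i → distribʳ _ _ _)) (sumTo-distrib-+ _ _ (suc n))

  mulPS-scaleˡ : ∀ a A B → (a ⊙ A) · B ≈ₚ a ⊙ (A · B)
  mulPS-scaleˡ a A B n = trans (sumTo-cong (suc n) (λ i → *-assoc _ _ _)) (sym (*-distribˡ-sumTo a _ (suc n)))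

  mulPS-shiftˡ : ∀ A B → shift A · B ≈ₚ shift (A · B)
  mulPS-shiftˡ A B zero = trans (+-identityˡ _) (zeroˡ _)
  mulPS-shiftˡ A B (suc n) = trans (sumTo-suc _ (suc n)) (trans (+-congʳ (zeroˡ _)) (+-identityˡ _))

  mulPS-identityˡ : ∀ A → onePS R · A ≈ₚ A
  mulPS-identityˡ A n =
    trans (sumTo-suc _ n) (trans (+-cong (*-identityˡ _) (sumTo-zero n (λ i _ → zeroˡ _))) (+-identityʳ _))

  mulPS-comm : ∀ A B → A · B ≈ₚ B · A
  mulPS-comm A B n = trans (sumTo-reverse _ n) (sumTo-cong< (suc n) λ i i<1+n →
    trans (reflexive (cong (λ k → A (n ∸ i) * B k) (ℕₚ.m∸[m∸n]≡n (ℕₚ.m<1+n⇒m≤n i<1+n)))) (*-comm _ _))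

  mulPS-assoc : ∀ A B C → (A · B) · C ≈ₚ A · (B · C)
  mulPS-assoc A B C n = begin
    Σ (λ k → Σ (λ i → A i * B (k ∸ i)) (suc k) * C (n ∸ k)) (suc n)
      ≈⟨ sumTo-cong (suc n) (λ k → *-distribʳ-sumTo _ _ (suc k)) ⟩
    Σ (λ k → Σ (λ i → A i * B (k ∸ i) * C (n ∸ k)) (suc k)) (suc n)
      ≈⟨ sumTo-triangle (λ i k → A i * B (k ∸ i) * C (n ∸ k)) n ⟩
    Σ (λ i → Σ (λ k → A i * B ((i ℕ.+ k) ∸ i) * C (n ∸ (i ℕ.+ k))) (suc (n ∸ i))) (suc n)
      ≈⟨ sumTo-cong (suc n) (λ i → sumTo-cong (suc (n ∸ i)) (λ k →
           trans (reflexive (cong₂ (λ u w → A i * B u * C w) (ℕₚ.m+n∸m≡n i k) (≡.sym (ℕₚ.∸-+-assoc n i k))))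
                 (*-assoc _ _ _))) ⟩
    Σ (λ i → Σ (λ k → A i * (B k * C ((n ∸ i) ∸ k))) (suc (n ∸ i))) (suc n)
      ≈⟨ sumTo-cong (suc n) (λ i → *-distribˡ-sumTo _ _ (suc (n ∸ i))) ⟨
    Σ (λ i → A i * Σ (λ k → B k * C ((n ∸ i) ∸ k)) (suc (n ∸ i))) (suc n) ∎
    where Σ = sumTo R

  mulPS-scaleʳ : ∀ a A B → A · (a ⊙ B) ≈ₚ a ⊙ (A · B)
  mulPS-scaleʳ a A B n = trans (mulPS-comm A (a ⊙ B) n) (trans (mulPS-scaleˡ a B A n) (*-congˡ (mulPS-comm B A n)))

  mulPS-shiftʳ : ∀ A B → A · shift B ≈ₚ shift (A · B)
  mulPS-shiftʳ A B n = trans (mulPS-comm A (shift B) n) (trans (mulPS-shiftˡ B A n) (shift-comm n))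
    where
    shift-comm : shift (B · A) ≈ₚ shift (A · B)
    shift-comm zero = refl
    shift-comm (suc n) = mulPS-comm B A n

  mulPS-identityʳ : ∀ A → A · onePS R ≈ₚ A
  mulPS-identityʳ A n = trans (mulPS-comm A (onePS R) n) (mulPS-identityˡ A n)

  private
    ∸-bound : ∀ j i k → suc i ≤ j → j ≤ k → j ∸ suc i < k
    ∸-bound (suc j) i (suc k) (s≤s _) (s≤s j≤k) = s≤s (ℕₚ.≤-trans (ℕₚ.m∸n≤m j i) j≤k)

  powPS-vanishes-below : ∀ A → A 0 ≈ 0# → ∀ k j → j < k → powPS R A k j ≈ 0#
  powPS-vanishes-below A A₀≈0 (suc k) j j<1+k = sumTo-zero (suc j) λ where
    zero _ → trans (*-congʳ A₀≈0) (zeroˡ _)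
    (suc i) i<1+j → trans (*-congˡ (powPS-vanishes-below A A₀≈0 k (j ∸ suc i)
                                      (∸-bound j i k (ℕₚ.m<1+n⇒m≤n i<1+j) (ℕₚ.m<1+n⇒m≤n j<1+k))))
                          (zeroʳ _)

  geom-unfold : ∀ A → A 0 ≈ 0# → geom R A ≈ₚ onePS R ⊕ A · geom R A
  geom-unfold A A₀≈0 n = sym (begin
    onePS R n + Σ (λ i → A i * Σ (λ k → P k (n ∸ i)) (suc (n ∸ i))) (suc n)
      ≈⟨ +-congˡ (sumTo-cong (suc n) λ i → *-congˡ (sym (sumTo-extend (λ k → P k (n ∸ i)) (suc (n ∸ i)) (suc n)
             (s≤s (ℕₚ.m∸n≤m n i)) (λ k le _ → powPS-vanishes-below A A₀≈0 k (n ∸ i) le)))) ⟩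
    onePS R n + Σ (λ i → A i * Σ (λ k → P k (n ∸ i)) (suc n)) (suc n)
      ≈⟨ +-congˡ (sumTo-cong (suc n) (λ i → *-distribˡ-sumTo _ _ (suc n))) ⟩
    onePS R n + Σ (λ i → Σ (λ k → A i * P k (n ∸ i)) (suc n)) (suc n)
      ≈⟨ +-congˡ (sumTo-comm _ (suc n) (suc n)) ⟩
    onePS R n + (Σ (λ k → P (suc k) n) n + P (suc n) n)
      ≈⟨ +-congˡ (trans (+-congˡ (powPS-vanishes-below A A₀≈0 (suc n) n ℕₚ.≤-refl)) (+-identityʳ _)) ⟩
    P 0 n + Σ (λ k → P (suc k) n) n
      ≈⟨ sumTo-suc _ n ⟨
    Σ (λ k → P k n) (suc n) ∎)
    where
    P = powPS R A
    Σ = sumTo R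

module MotzkinPaths {c ℓ} (R : CommutativeRing c ℓ) (d l : ℕ → CommutativeRing.Carrier R) where
  open CommutativeRing R hiding (zero)
  open import Relation.Binary.Reasoning.Setoid setoid
  open PowerSeries R

  -- Paths of length n from height 0 to height h: a level step at height h weighs l h,
  -- a rise to height h weighs d h, a fall weighs 1.
  motzkin : ℕ → ℕ → Carrier
  motzkin zero zero = 1#
  motzkin zero (suc h) = 0#
  motzkin (suc n) zero = l 0 * motzkin n 0 + motzkin n 1
  motzkin (suc n) (suc h) = l (suc h) * motzkin n (suc h) + motzkin n (suc (suc h)) + d (suc h) * motzkin n h

  lin-decompose : ∀ a b F → lin R a b F ≈ₚ shift (a ⊙ onePS R ⊕ shift (b ⊙ F))
  lin-decompose a b F zero = refl
  lin-decompose a b F (suc zero) = sym (trans (+-identityʳ _) (*-identityʳ a))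
  lin-decompose a b F (suc (suc n)) = sym (trans (+-congʳ (zeroʳ a)) (+-identityˡ _))

  cf-constant : ∀ k h → cf R d l k h 0 ≈ 1#
  cf-constant zero h = +-identityˡ _
  cf-constant (suc k) h = +-identityˡ _

  -- Cutting a path from 0 to h at its last visits to 0, 1, …, h − 1 factors its generating
  -- function as climb h times the excursions above h.
  module Truncated (m : ℕ) where
    private
      _·_ : PS R → PS R → PS R
      _·_ = mulPS R
      infixl 7 _·_

    level : ℕ → PS R
    level h = cf R d l (m ∸ h) h

    climb : ℕ → PS R
    climb zero = onePS R
    climb (suc h) = shift (d (suc h) ⊙ (level h · climb h))

    reach : ℕ → PS R
    reach h = level h · climb h

    level-unfold : ∀ h → h < m → level h ≡ geom R (lin R (l h) (d (suc h)) (level (suc h)))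
    level-unfold h h<m = cong (λ k → cf R d l k h) (∸-suc m h h<m)
      where
      ∸-suc : ∀ m h → h < m → m ∸ h ≡ suc (m ∸ suc h)
      ∸-suc (suc m) zero _ = ≡.refl
      ∸-suc (suc m) (suc h) (s≤s h<m) = ∸-suc m h h<m

    reach-suc : ∀ h → h < m → ∀ n → reach h (suc n) ≈ climb h (suc n) + (l h * reach h n + reach (suc h) n)
    reach-suc h h<m n = begin
      (level h · climb h) (suc n)
        ≈⟨ mulPS-cong {B = climb h} (≡.subst (λ G → G ≈ₚ onePS R ⊕ B · G) (≡.sym (level-unfold h h<m))
                                             (geom-unfold B refl))
                                   (λ _ → refl) (suc n) ⟩
      ((onePS R ⊕ B · level h) · climb h) (suc n)
        ≈⟨ mulPS-distribʳ (onePS R) (B · level h) (climb h) (suc n) ⟩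
      (onePS R · climb h) (suc n) + (B · level h · climb h) (suc n)
        ≈⟨ +-cong (mulPS-identityˡ (climb h) (suc n)) (mulPS-assoc B (level h) (climb h) (suc n)) ⟩
      climb h (suc n) + (B · reach h) (suc n)
        ≈⟨ +-congˡ (trans (mulPS-cong {B = reach h} (lin-decompose (l h) (d (suc h)) (level (suc h))) (λ _ → refl) (suc n))
                          (mulPS-shiftˡ B′ (reach h) (suc n))) ⟩
      climb h (suc n) + (B′ · reach h) n
        ≈⟨ +-congˡ (mulPS-distribʳ _ _ (reach h) n) ⟩
      climb h (suc n) + (((l h ⊙ onePS R) · reach h) n + (shift (d (suc h) ⊙ level (suc h)) · reach h) n)
        ≈⟨ +-congˡ (+-cong (trans (mulPS-scaleˡ (l h) (onePS R) (reach h) n) (*-congˡ (mulPS-identityˡ (reach h) n)))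
                           (trans (mulPS-shiftˡ (d (suc h) ⊙ level (suc h)) (reach h) n) (factor-d n))) ⟩
      climb h (suc n) + (l h * reach h n + reach (suc h) n) ∎
      where
      B = lin R (l h) (d (suc h)) (level (suc h))
      B′ = l h ⊙ onePS R ⊕ shift (d (suc h) ⊙ level (suc h))
      factor-d : shift ((d (suc h) ⊙ level (suc h)) · reach h) ≈ₚ reach (suc h)
      factor-d zero = sym (mulPS-shiftʳ (level (suc h)) (d (suc h) ⊙ reach h) zero)
      factor-d (suc n) = sym (trans (mulPS-shiftʳ (level (suc h)) (d (suc h) ⊙ reach h) (suc n))
                                   (trans (mulPS-scaleʳ (d (suc h)) (level (suc h)) (reach h) n)
                                          (sym (mulPS-scaleˡ (d (suc h)) (level (suc h)) (reach h) n))))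

    motzkin≈reach : ∀ n h → h ℕ.+ n ≤ m → motzkin n h ≈ reach h n
    motzkin≈reach zero zero _ = sym (trans (+-identityˡ _) (trans (*-identityʳ _) (cf-constant (m ∸ 0) 0)))
    motzkin≈reach zero (suc h) _ = sym (trans (+-identityˡ _) (zeroʳ _))
    motzkin≈reach (suc n) zero 1+n≤m = begin
      l 0 * motzkin n 0 + motzkin n 1
        ≈⟨ +-cong (*-congˡ (motzkin≈reach n 0 (ℕₚ.≤-trans (ℕₚ.n≤1+n n) 1+n≤m))) (motzkin≈reach n 1 1+n≤m) ⟩
      l 0 * reach 0 n + reach 1 n
        ≈⟨ +-identityˡ _ ⟨
      0# + (l 0 * reach 0 n + reach 1 n)
        ≈⟨ reach-suc 0 (ℕₚ.≤-trans (s≤s z≤n) 1+n≤m) n ⟨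
      reach 0 (suc n) ∎
    motzkin≈reach (suc n) (suc h) h+n+2≤m = begin
      l (suc h) * motzkin n (suc h) + motzkin n (suc (suc h)) + d (suc h) * motzkin n h
        ≈⟨ +-cong (+-cong (*-congˡ (motzkin≈reach n (suc h) h+n+1≤m)) (motzkin≈reach n (suc (suc h)) h+n+2≤m′))
                  (*-congˡ (motzkin≈reach n h h+n≤m)) ⟩
      l (suc h) * reach (suc h) n + reach (suc (suc h)) n + d (suc h) * reach h n
        ≈⟨ +-comm _ _ ⟩
      d (suc h) * reach h n + (l (suc h) * reach (suc h) n + reach (suc (suc h)) n)
        ≈⟨ reach-suc (suc h) h+1<m n ⟨
      reach (suc h) (suc n) ∎
      where
      h+n+2≤m′ : suc (suc h) ℕ.+ n ≤ m
      h+n+2≤m′ = ℕₚ.≤-trans (ℕₚ.≤-reflexive (≡.sym (ℕₚ.+-suc (suc h) n))) h+n+2≤m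
      h+n+1≤m : suc h ℕ.+ n ≤ m
      h+n+1≤m = ℕₚ.≤-trans (ℕₚ.n≤1+n _) h+n+2≤m′
      h+n≤m : h ℕ.+ n ≤ m
      h+n≤m = ℕₚ.≤-trans (ℕₚ.n≤1+n _) h+n+1≤m
      h+1<m : suc h < m
      h+1<m = ℕₚ.≤-trans (s≤s (s≤s (ℕₚ.m≤m+n h n))) h+n+2≤m′

  motzkin≈cf : ∀ m n → n ≤ m → motzkin n 0 ≈ cf R d l m 0 n
  motzkin≈cf m n n≤m = trans (motzkin≈reach n 0 n≤m) (mulPS-identityʳ (level 0) n)
    where open Truncated m

iverson : Bool → ℕ
iverson true = 1
iverson false = 0

count-tabulate : ∀ {n m} (g : Fin n → Fin m) (p : Fin m → Bool) →
  List.foldr (λ i acc → if p i then suc acc else acc) 0 (List.tabulate g) ≡ ∑ (λ i → iverson (p (g i)))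
count-tabulate {zero} g p = ≡.refl
count-tabulate {suc n} g p with p (g Fin.zero)
... | true = cong suc (count-tabulate (g ∘ Fin.suc) p)
... | false = count-tabulate (g ∘ Fin.suc) p

count≡∑ : ∀ {n} (p : Fin n → Bool) → count p ≡ ∑ (λ i → iverson (p i))
count≡∑ p = count-tabulate id p

sum-map-tabulate : ∀ {n m} (g : Fin n → Fin m) (F : Fin m → ℕ) →
  List.foldr ℕ._+_ 0 (List.map F (List.tabulate g)) ≡ ∑ (λ i → F (g i))
sum-map-tabulate {zero} g F = ≡.refl
sum-map-tabulate {suc n} g F = cong (F (g Fin.zero) ℕ.+_) (sum-map-tabulate (g ∘ Fin.suc) F)

∑-<ᵇ : ∀ n c → c ≤ n → ∑ {n} (λ i → iverson (toℕ i <ᵇ c)) ≡ c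
∑-<ᵇ zero zero _ = ≡.refl
∑-<ᵇ (suc n) zero _ = ∑-<ᵇ n zero z≤n
∑-<ᵇ (suc n) (suc c) (s≤s c≤n) = cong suc (∑-<ᵇ n c c≤n)

all-tabulate⁻ : ∀ {n m} (g : Fin n → Fin m) (p : Fin m → Bool) → all p (List.tabulate g) ≡ true → ∀ i → p (g i) ≡ true
all-tabulate⁻ {suc n} g p all-p i with p (g Fin.zero) in p₀
all-tabulate⁻ {suc n} g p all-p Fin.zero | true = p₀
all-tabulate⁻ {suc n} g p all-p (Fin.suc i) | true = all-tabulate⁻ (g ∘ Fin.suc) p all-p i

all-tabulate⁺ : ∀ {n m} (g : Fin n → Fin m) (p : Fin m → Bool) → (∀ i → p (g i) ≡ true) →
  all p (List.tabulate g) ≡ true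
all-tabulate⁺ {zero} g p all-p = ≡.refl
all-tabulate⁺ {suc n} g p all-p rewrite all-p Fin.zero = all-tabulate⁺ (g ∘ Fin.suc) p (all-p ∘ Fin.suc)

all-applyUpTo⁺ : ∀ (p : ℕ → Bool) (g : ℕ → ℕ) m → (∀ k → p (g k) ≡ true) → all p (List.applyUpTo g m) ≡ true
all-applyUpTo⁺ p g zero all-p = ≡.refl
all-applyUpTo⁺ p g (suc m) all-p rewrite all-p 0 = all-applyUpTo⁺ p (g ∘ suc) m (all-p ∘ suc)

Involutive : ∀ {n} → (Fin n → Fin n) → Set
Involutive f = ∀ i → f (f i) ≡ i

∑-∘-involution : ∀ {n} (f : Fin n → Fin n) → Involutive f → ∀ (g : Fin n → ℕ) → ∑ (λ i → g (f i)) ≡ ∑ g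
∑-∘-involution f f-inv g = ≡.sym (sum-permute g (permutation f f f-inv f-inv))

isInvolution⇒Involutive : ∀ {n} (π : Vec (Fin n) n) → isInvolution π ≡ true → Involutive (app π)
isInvolution⇒Involutive π e i = ⌊⌋-true⁻¹ (app π (app π i) ≟ i) (all-tabulate⁻ id _ e i)

Involutive⇒isInvolution : ∀ {n} (π : Vec (Fin n) n) → Involutive (app π) → isInvolution π ≡ true
Involutive⇒isInvolution π π-inv = all-tabulate⁺ id _ (λ i → ⌊⌋-true (app π (app π i) ≟ i) (π-inv i))

inverted : ∀ {n} → (Fin n → Fin n) → Fin n → Fin n → ℕ
inverted f i k = iverson ((toℕ i <ᵇ toℕ k) ∧ (toℕ (f k) <ᵇ toℕ (f i)))

fixedPoints excedances weakExcedances inversions : ∀ {n} → (Fin n → Fin n) → ℕ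
fixedPoints f = ∑ (λ i → iverson ⌊ f i ≟ i ⌋)
excedances f = ∑ (λ i → iverson (toℕ i <ᵇ toℕ (f i)))
weakExcedances f = ∑ (λ i → iverson (toℕ i ≤ᵇ toℕ (f i)))
inversions f = ∑ (λ i → ∑ (λ k → inverted f i k))

fp≡fixedPoints : ∀ {n} (π : Vec (Fin n) n) → fp π ≡ fixedPoints (app π)
fp≡fixedPoints {n} π = count≡∑ {n} _

exc≡excedances : ∀ {n} (π : Vec (Fin n) n) → exc π ≡ excedances (app π)
exc≡excedances {n} π = count≡∑ {n} _

inv≡inversions : ∀ {n} (π : Vec (Fin n) n) → inv π ≡ inversions (app π)
inv≡inversions {n} π = ≡.trans (sum-map-tabulate {n} id _) (sum-cong-≗ {n} (λ i → count≡∑ {n} _))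

iter-involution : ∀ {n} (π : Vec (Fin n) n) → Involutive (app π) → ∀ k i → iter π k i ≡ i ⊎ iter π k i ≡ app π i
iter-involution π π-inv zero i = inj₁ ≡.refl
iter-involution π π-inv (suc k) i with iter-involution π π-inv k i
... | inj₁ e = inj₂ (cong (app π) e)
... | inj₂ e = inj₁ (≡.trans (cong (app π) e) (π-inv i))

-- The cycle of i is {i, π i}, so i is its minimum exactly when i ≤ π i.
cycleMinimum≡≤ᵇ : ∀ {n} (π : Vec (Fin n) n) → Involutive (app π) → ∀ i →
  all (λ k → toℕ i ≤ᵇ toℕ (iter π k i)) (List.upTo n) ≡ (toℕ i ≤ᵇ toℕ (app π i))
cycleMinimum≡≤ᵇ {n} π π-inv i = go n ≡.refl i
  where
  go : ∀ m → m ≡ n → (i : Fin n) →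
       all (λ k → toℕ i ≤ᵇ toℕ (iter π k i)) (List.upTo m) ≡ (toℕ i ≤ᵇ toℕ (app π i))
  go zero ≡.refl ()
  go (suc zero) ≡.refl i rewrite ≤ᵇ-refl (toℕ i) with app π i | i
  ... | Fin.zero | Fin.zero = ≡.refl
  go (suc (suc m)) ≡.refl i rewrite ≤ᵇ-refl (toℕ i) with toℕ i ≤ᵇ toℕ (app π i) in i≤πi
  ... | false = ≡.refl
  ... | true = all-applyUpTo⁺ _ (suc ∘ suc) m (λ k → below-orbit (suc (suc k)))
    where
    below-orbit : ∀ k → (toℕ i ≤ᵇ toℕ (iter π k i)) ≡ true
    below-orbit k with iter-involution π π-inv k i
    ... | inj₁ e rewrite e = ≤ᵇ-refl (toℕ i)
    ... | inj₂ e rewrite e = i≤πi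

cyc≡weakExcedances : ∀ {n} (π : Vec (Fin n) n) → Involutive (app π) → cyc π ≡ weakExcedances (app π)
cyc≡weakExcedances {n} π π-inv =
  ≡.trans (count≡∑ {n} _) (sum-cong-≗ {n} (λ i → cong iverson (cycleMinimum≡≤ᵇ π π-inv i)))

inverted-diagonal : ∀ {n} (f : Fin n → Fin n) i → inverted f i i ≡ 0
inverted-diagonal f i = cong (λ b → iverson (b ∧ (toℕ (f i) <ᵇ toℕ (f i)))) (<ᵇ-irrefl (toℕ i))

∑-inverted-before : ∀ {n} (f : Fin n → Fin n) p →
  (∀ i → toℕ i < toℕ p → toℕ (f p) < toℕ (f i)) → ∑ (λ i → inverted f i p) ≡ toℕ p
∑-inverted-before {n} f p above = ≡.trans (sum-cong-≗ {n} pointwise) (∑-<ᵇ n (toℕ p) (ℕₚ.<⇒≤ (toℕ<n p)))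
  where
  pointwise : ∀ i → inverted f i p ≡ iverson (toℕ i <ᵇ toℕ p)
  pointwise i with toℕ i <ᵇ toℕ p in i<p
  ... | false = ≡.refl
  ... | true = cong iverson (<ᵇ-true (above i (<ᵇ-true⁻¹ i<p)))

∑-inverted-after : ∀ {n} (f : Fin n → Fin n) → Involutive f → ∀ p →
  (∀ k → toℕ (f k) < toℕ (f p) → toℕ p < toℕ k) → ∑ (λ k → inverted f p k) ≡ toℕ (f p)
∑-inverted-after {n} f f-inv p after = begin
  ∑ (λ k → inverted f p k)                           ≡⟨ sum-cong-≗ {n} pointwise ⟩
  ∑ {n} (λ k → iverson (toℕ (f k) <ᵇ toℕ (f p)))     ≡⟨ ∑-∘-involution f f-inv (λ k → iverson (toℕ k <ᵇ toℕ (f p))) ⟩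
  ∑ {n} (λ k → iverson (toℕ k <ᵇ toℕ (f p)))         ≡⟨ ∑-<ᵇ n (toℕ (f p)) (ℕₚ.<⇒≤ (toℕ<n (f p))) ⟩
  toℕ (f p)                                      ∎
  where
  open ≡.≡-Reasoning
  pointwise : ∀ k → inverted f p k ≡ iverson (toℕ (f k) <ᵇ toℕ (f p))
  pointwise k with toℕ (f k) <ᵇ toℕ (f p) in fk<fp
  ... | false = cong iverson (∧-zeroʳ _)
  ... | true = cong iverson (≡.trans (∧-identityʳ _) (<ᵇ-true (after k (<ᵇ-true⁻¹ fk<fp))))

private
  subst-< : ∀ {a a′ b b′ : ℕ} → a ≡ a′ → b ≡ b′ → a′ < b′ → a < b
  subst-< ≡.refl ≡.refl a<b = a<b

toℕ-punchIn-< : ∀ {n} (i : Fin (suc n)) (j : Fin n) → toℕ j < toℕ i → toℕ (punchIn i j) ≡ toℕ j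
toℕ-punchIn-< (Fin.suc i) Fin.zero _ = ≡.refl
toℕ-punchIn-< (Fin.suc i) (Fin.suc j) (s≤s j<i) = cong suc (toℕ-punchIn-< i j j<i)

toℕ-punchIn-≥ : ∀ {n} (i : Fin (suc n)) (j : Fin n) → toℕ i ≤ toℕ j → toℕ (punchIn i j) ≡ suc (toℕ j)
toℕ-punchIn-≥ Fin.zero j _ = ≡.refl
toℕ-punchIn-≥ (Fin.suc i) (Fin.suc j) (s≤s i≤j) = cong suc (toℕ-punchIn-≥ i j i≤j)

toℕ-punchIn-≤ : ∀ {n} (i : Fin (suc n)) (j : Fin n) → toℕ (punchIn i j) ≤ suc (toℕ j)
toℕ-punchIn-≤ Fin.zero j = ℕₚ.≤-refl
toℕ-punchIn-≤ (Fin.suc i) Fin.zero = z≤n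
toℕ-punchIn-≤ (Fin.suc i) (Fin.suc j) = s≤s (toℕ-punchIn-≤ i j)

≤-toℕ-punchIn : ∀ {n} (i : Fin (suc n)) (j : Fin n) → toℕ j ≤ toℕ (punchIn i j)
≤-toℕ-punchIn Fin.zero j = ℕₚ.n≤1+n _
≤-toℕ-punchIn (Fin.suc i) Fin.zero = z≤n
≤-toℕ-punchIn (Fin.suc i) (Fin.suc j) = s≤s (≤-toℕ-punchIn i j)

Monotone : ∀ {m n} → (Fin m → Fin n) → Set
Monotone e = ∀ x y → toℕ x < toℕ y → toℕ (e x) < toℕ (e y)

punchIn-monotone : ∀ {n} (i : Fin (suc n)) → Monotone (punchIn i)
punchIn-monotone i x y x<y = ℕₚ.≤∧≢⇒< (punchIn-mono-≤ i x y (ℕₚ.<⇒≤ x<y))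
  (λ e → ℕₚ.<⇒≢ x<y (cong toℕ (punchIn-injective i x y (toℕ-injective e))))
  where open import Data.Fin.Properties using (punchIn-mono-≤)

monotone-∘ : ∀ {k m n} {e₁ : Fin m → Fin n} {e₂ : Fin k → Fin m} → Monotone e₁ → Monotone e₂ → Monotone (e₁ ∘ e₂)
monotone-∘ e₁-mono e₂-mono x y x<y = e₁-mono _ _ (e₂-mono x y x<y)

module MonotoneEmbedding {m n} (e : Fin m → Fin n) (e-mono : Monotone e) where

  injective : ∀ {x y} → e x ≡ e y → x ≡ y
  injective {x} {y} ex≡ey with ℕₚ.<-cmp (toℕ x) (toℕ y)
  ... | tri< x<y _ _ = ⊥-elim (ℕₚ.<-irrefl (cong toℕ ex≡ey) (e-mono x y x<y))
  ... | tri≈ _ x≡y _ = toℕ-injective x≡y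
  ... | tri> _ _ y<x = ⊥-elim (ℕₚ.<-irrefl (cong toℕ (≡.sym ex≡ey)) (e-mono y x y<x))

  <ᵇ-preserved : ∀ x y → (toℕ (e x) <ᵇ toℕ (e y)) ≡ (toℕ x <ᵇ toℕ y)
  <ᵇ-preserved x y with ℕₚ.<-cmp (toℕ x) (toℕ y)
  ... | tri< x<y _ _ = ≡.trans (<ᵇ-true (e-mono x y x<y)) (≡.sym (<ᵇ-true x<y))
  ... | tri≈ _ x≡y _ rewrite toℕ-injective x≡y = ≡.trans (<ᵇ-irrefl (toℕ (e y))) (≡.sym (<ᵇ-irrefl (toℕ y)))
  ... | tri> _ _ y<x = ≡.trans (<ᵇ-false (ℕₚ.<⇒≤ (e-mono y x y<x))) (≡.sym (<ᵇ-false (ℕₚ.<⇒≤ y<x)))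

  ≤ᵇ-preserved : ∀ x y → (toℕ (e x) ≤ᵇ toℕ (e y)) ≡ (toℕ x ≤ᵇ toℕ y)
  ≤ᵇ-preserved x y with ℕₚ.<-cmp (toℕ x) (toℕ y)
  ... | tri< x<y _ _ = ≡.trans (≤ᵇ-true (ℕₚ.<⇒≤ (e-mono x y x<y))) (≡.sym (≤ᵇ-true (ℕₚ.<⇒≤ x<y)))
  ... | tri≈ _ x≡y _ rewrite toℕ-injective x≡y = ≡.trans (≤ᵇ-refl (toℕ (e y))) (≡.sym (≤ᵇ-refl (toℕ y)))
  ... | tri> _ _ y<x = ≡.trans (≤ᵇ-false (e-mono y x y<x)) (≡.sym (≤ᵇ-false y<x))

  ≟-preserved : ∀ x y → ⌊ e x ≟ e y ⌋ ≡ ⌊ x ≟ y ⌋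
  ≟-preserved x y with x ≟ y
  ... | yes x≡y = ⌊⌋-true (e x ≟ e y) (cong e x≡y)
  ... | no x≢y = ⌊⌋-false (e x ≟ e y) (x≢y ∘ injective)

  module Restriction (f : Fin n → Fin n) (g : Fin m → Fin m) (f∘e≡e∘g : ∀ x → f (e x) ≡ e (g x)) where

    fixedPoints-restrict : ∑ (λ x → iverson ⌊ f (e x) ≟ e x ⌋) ≡ fixedPoints g
    fixedPoints-restrict = sum-cong-≗ {m} λ x →
      cong iverson (≡.trans (cong (λ z → ⌊ z ≟ e x ⌋) (f∘e≡e∘g x)) (≟-preserved (g x) x))

    excedances-restrict : ∑ (λ x → iverson (toℕ (e x) <ᵇ toℕ (f (e x)))) ≡ excedances g
    excedances-restrict = sum-cong-≗ {m} λ x →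
      cong iverson (≡.trans (cong (λ z → toℕ (e x) <ᵇ toℕ z) (f∘e≡e∘g x)) (<ᵇ-preserved x (g x)))

    weakExcedances-restrict : ∑ (λ x → iverson (toℕ (e x) ≤ᵇ toℕ (f (e x)))) ≡ weakExcedances g
    weakExcedances-restrict = sum-cong-≗ {m} λ x →
      cong iverson (≡.trans (cong (λ z → toℕ (e x) ≤ᵇ toℕ z) (f∘e≡e∘g x)) (≤ᵇ-preserved x (g x)))

    inversions-restrict :
      ∑ (λ x → ∑ (λ y → inverted f (e x) (e y))) ≡ inversions g
    inversions-restrict = sum-cong-≗ {m} λ x → sum-cong-≗ {m} λ y → cong iverson (cong₂ _∧_ (<ᵇ-preserved x y)
      (≡.trans (cong₂ (λ u w → toℕ u <ᵇ toℕ w) (f∘e≡e∘g y) (f∘e≡e∘g x)) (<ᵇ-preserved (g y) (g x))))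

-- An involution of h + n points whose first h points open arcs is the suffix, of length n,
-- of a path standing at height h.
OpenPrefix : ∀ {n} → ℕ → (Fin n → Fin n) → Set
OpenPrefix h f = ∀ i → toℕ i < h → h ≤ toℕ (f i)

punchOutOr : ∀ {N} (j w : Fin (suc N)) → Fin N → Fin N
punchOutOr j w x with j ≟ w
... | yes _ = x
... | no j≢w = punchOut j≢w

punchIn-punchOutOr : ∀ {N} (j w : Fin (suc N)) x → j ≢ w → punchIn j (punchOutOr j w x) ≡ w
punchIn-punchOutOr j w x j≢w with j ≟ w
... | yes j≡w = ⊥-elim (j≢w j≡w)
... | no j≢w′ = punchIn-punchOut j≢w′

delete : ∀ {N} (j : Fin (suc N)) → (Fin (suc N) → Fin (suc N)) → Fin N → Fin N
delete j f x = punchOutOr j (f (punchIn j x)) x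

punchIn-delete : ∀ {N} (j : Fin (suc N)) f x → j ≢ f (punchIn j x) → punchIn j (delete j f x) ≡ f (punchIn j x)
punchIn-delete j f x = punchIn-punchOutOr j (f (punchIn j x)) x

delete-cong : ∀ {N} (j : Fin (suc N)) {f f′} → (∀ k → f k ≡ f′ k) → ∀ x → delete j f x ≡ delete j f′ x
delete-cong j f≗f′ x = cong (λ w → punchOutOr j w x) (f≗f′ (punchIn j x))

punchIn-view : ∀ {N} (j k : Fin (suc N)) → j ≡ k ⊎ Σ[ x ∈ Fin N ] k ≡ punchIn j x
punchIn-view j k with j ≟ k
... | yes j≡k = inj₁ j≡k
... | no j≢k = inj₂ (punchOut j≢k , ≡.sym (punchIn-punchOut j≢k))

insert : ∀ {N} {C : Set} (j : Fin (suc N)) → C → (Fin N → C) → Fin (suc N) → C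
insert j v G k with j ≟ k
... | yes _ = v
... | no j≢k = G (punchOut j≢k)

insert-cong : ∀ {N} {C : Set} (j : Fin (suc N)) (v : C) {G G′} → (∀ y → G y ≡ G′ y) →
  ∀ k → insert j v G k ≡ insert j v G′ k
insert-cong j v G≗G′ k with j ≟ k
... | yes _ = ≡.refl
... | no _ = G≗G′ _

insert-at : ∀ {N} {C : Set} (j : Fin (suc N)) (v : C) G → insert j v G j ≡ v
insert-at j v G with j ≟ j
... | yes _ = ≡.refl
... | no j≢j = ⊥-elim (j≢j ≡.refl)

insert-punchIn : ∀ {N} {C : Set} (j : Fin (suc N)) (v : C) G x → insert j v G (punchIn j x) ≡ G x
insert-punchIn j v G x with j ≟ punchIn j x
... | yes j≡ = ⊥-elim (punchInᵢ≢i j x (≡.sym j≡))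
... | no _ = cong G (≡.trans (punchOut-cong j ≡.refl) (punchOut-punchIn j))

∑-remove₂ : ∀ {M} (a : Fin (suc (suc M))) (b : Fin (suc M)) (t : Fin (suc (suc M)) → ℕ) →
  ∑ t ≡ t a ℕ.+ (t (punchIn a b) ℕ.+ ∑ (λ x → t (punchIn a (punchIn b x))))
∑-remove₂ a b t = ≡.trans (sum-remove {i = a} t) (cong (t a ℕ.+_) (sum-remove {i = b} (t ∘ punchIn a)))

module FixedPointRemoval {N} (j : Fin (suc N)) where
  private
    h = toℕ j
    e = punchIn j
  open MonotoneEmbedding e (punchIn-monotone j)

  module Remove (f : Fin (suc N) → Fin (suc N)) (f-inv : Involutive f) (f-open : OpenPrefix h f) (fj≡j : f j ≡ j) where
    g : Fin N → Fin N
    g = delete j f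

    f∘e≡e∘g : ∀ x → f (e x) ≡ e (g x)
    f∘e≡e∘g x = ≡.sym (punchIn-delete j f x j≢f[ex])
      where
      j≢f[ex] : j ≢ f (e x)
      j≢f[ex] j≡ = punchInᵢ≢i j x (≡.trans (≡.sym (f-inv (e x))) (≡.trans (cong f (≡.sym j≡)) fj≡j))

    involutive : Involutive g
    involutive x = injective (≡.trans (≡.sym (f∘e≡e∘g (g x))) (≡.trans (cong f (≡.sym (f∘e≡e∘g x))) (f-inv (e x))))

    openPrefix : OpenPrefix h g
    openPrefix x x<h = ℕₚ.≮⇒≥ λ gx<h →
      ℕₚ.<⇒≱ (subst-< (cong toℕ (f∘e≡e∘g x)) ≡.refl (subst-< (toℕ-punchIn-< j (g x) gx<h) ≡.refl gx<h))
             (f-open (e x) (subst-< (toℕ-punchIn-< j x x<h) ≡.refl x<h))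

    restore : ∀ k → insert j j (e ∘ g) k ≡ f k
    restore k with punchIn-view j k
    ... | inj₁ ≡.refl = ≡.trans (insert-at j j _) (≡.sym fj≡j)
    ... | inj₂ (x , ≡.refl) = ≡.trans (insert-punchIn j j _ x) (≡.sym (f∘e≡e∘g x))

    open Restriction f g f∘e≡e∘g

    fixedPoints-step : fixedPoints f ≡ suc (fixedPoints g)
    fixedPoints-step = ≡.trans (sum-remove {i = j} (λ i → iverson ⌊ f i ≟ i ⌋))
                               (cong₂ ℕ._+_ (cong iverson (⌊⌋-true (f j ≟ j) fj≡j)) fixedPoints-restrict)

    excedances-step : excedances f ≡ excedances g
    excedances-step = ≡.trans (sum-remove {i = j} (λ i → iverson (toℕ i <ᵇ toℕ (f i))))
      (cong₂ ℕ._+_ (cong iverson (≡.trans (cong (λ k → h <ᵇ toℕ k) fj≡j) (<ᵇ-irrefl h))) excedances-restrict)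

    weakExcedances-step : weakExcedances f ≡ suc (weakExcedances g)
    weakExcedances-step = ≡.trans (sum-remove {i = j} (λ i → iverson (toℕ i ≤ᵇ toℕ (f i))))
      (cong₂ ℕ._+_ (cong iverson (≡.trans (cong (λ k → h ≤ᵇ toℕ k) fj≡j) (≤ᵇ-refl h))) weakExcedances-restrict)

    inversions-split : inversions f ≡ ∑ (inverted f j) ℕ.+ (∑ (λ i → inverted f i j) ℕ.+ inversions g)
    inversions-split = begin
      ∑ (λ i → ∑ (inverted f i))
        ≡⟨ sum-remove {i = j} (λ i → ∑ (inverted f i)) ⟩
      ∑ (inverted f j) ℕ.+ ∑ (λ x → ∑ (inverted f (e x)))
        ≡⟨ cong (∑ (inverted f j) ℕ.+_) (≡.trans (sum-cong-≗ {N} (λ x → sum-remove {i = j} (inverted f (e x))))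
              (∑-distrib-+ (λ x → inverted f (e x) j) (λ x → ∑ (λ y → inverted f (e x) (e y))))) ⟩
      ∑ (inverted f j) ℕ.+ (∑ (λ x → inverted f (e x) j) ℕ.+ ∑ (λ x → ∑ (λ y → inverted f (e x) (e y))))
        ≡⟨ cong₂ (λ u w → ∑ (inverted f j) ℕ.+ (u ℕ.+ w)) (≡.sym column) inversions-restrict ⟩
      ∑ (inverted f j) ℕ.+ (∑ (λ i → inverted f i j) ℕ.+ inversions g) ∎
      where
      open ≡.≡-Reasoning
      column : ∑ (λ i → inverted f i j) ≡ ∑ (λ x → inverted f (e x) j)
      column = ≡.trans (sum-remove {i = j} (λ i → inverted f i j))
                       (cong (ℕ._+ ∑ (λ x → inverted f (e x) j)) (inverted-diagonal f j))

    -- Each of the h arcs passing over the fixed point j contributes two inversions.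
    inversions-step : inversions f ≡ h ℕ.+ (h ℕ.+ inversions g)
    inversions-step = ≡.trans inversions-split (cong₂ (λ u w → u ℕ.+ (w ℕ.+ inversions g)) after before)
      where
      fj≡h : toℕ (f j) ≡ h
      fj≡h = cong toℕ fj≡j
      before : ∑ (λ i → inverted f i j) ≡ h
      before = ∑-inverted-before f j λ i i<h → subst-< fj≡h ≡.refl (ℕₚ.≤∧≢⇒< (f-open i i<h) λ h≡fi →
        ℕₚ.<-irrefl (cong toℕ (≡.trans (≡.sym (f-inv i)) (≡.trans (cong f (toℕ-injective (≡.sym h≡fi))) fj≡j))) i<h)
      after : ∑ (inverted f j) ≡ h
      after = ≡.trans (∑-inverted-after f f-inv j λ k fk<h → ℕₚ.≤∧≢⇒<
                (ℕₚ.≤-trans (f-open (f k) (subst-< ≡.refl (≡.sym fj≡h) fk<h)) (ℕₚ.≤-reflexive (cong toℕ (f-inv k))))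
                (λ h≡k → ℕₚ.<-irrefl (cong (toℕ ∘ f) (toℕ-injective (≡.sym h≡k))) fk<h))
              fj≡h

  module Insert (g : Fin N → Fin N) (g-inv : Involutive g) (g-open : OpenPrefix h g) where
    f : Fin (suc N) → Fin (suc N)
    f = insert j j (e ∘ g)

    fj≡j : f j ≡ j
    fj≡j = insert-at j j _

    f∘e≡e∘g : ∀ x → f (e x) ≡ e (g x)
    f∘e≡e∘g x = insert-punchIn j j _ x

    involutive : Involutive f
    involutive k with punchIn-view j k
    ... | inj₁ ≡.refl = ≡.trans (cong f fj≡j) fj≡j
    ... | inj₂ (x , ≡.refl) = ≡.trans (cong f (f∘e≡e∘g x)) (≡.trans (f∘e≡e∘g (g x)) (cong e (g-inv x)))

    openPrefix : OpenPrefix h f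
    openPrefix k k<h with punchIn-view j k
    ... | inj₁ ≡.refl = ⊥-elim (ℕₚ.<-irrefl ≡.refl k<h)
    ... | inj₂ (x , ≡.refl) = ℕₚ.≤-trans h≤gx (ℕₚ.≤-trans (ℕₚ.n≤1+n _)
                                (ℕₚ.≤-reflexive (≡.sym (≡.trans (cong toℕ (f∘e≡e∘g x)) (toℕ-punchIn-≥ j (g x) h≤gx)))))
      where
      h≤gx : h ≤ toℕ (g x)
      h≤gx = g-open x (ℕₚ.≤-<-trans (≤-toℕ-punchIn j x) k<h)

    remove : ∀ x → delete j f x ≡ g x
    remove x = injective (≡.trans (punchIn-delete j f x (λ j≡ → punchInᵢ≢i j (g x) (≡.sym (≡.trans j≡ (f∘e≡e∘g x)))))
                                  (f∘e≡e∘g x))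

-- The arc joins a to top = punchIn a b; the hypothesis a ≤ b says exactly that a < top.
module ArcRemoval {M} (a : Fin (suc (suc M))) (b : Fin (suc M)) (a≤b : toℕ a ≤ toℕ b) where
  top : Fin (suc (suc M))
  top = punchIn a b

  private
    A = toℕ a
    B = toℕ b
    H = toℕ top
    e : Fin M → Fin (suc (suc M))
    e = punchIn a ∘ punchIn b
  open MonotoneEmbedding e (monotone-∘ (punchIn-monotone a) (punchIn-monotone b))

  H≡1+B : H ≡ suc B
  H≡1+B = toℕ-punchIn-≥ a b a≤b

  A<H : A < H
  A<H = subst-< ≡.refl H≡1+B (s≤s a≤b)

  a≢top : a ≢ top
  a≢top a≡top = ℕₚ.<-irrefl (cong toℕ a≡top) A<H

  e-below : ∀ y → toℕ y < B → toℕ (e y) < H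
  e-below y y<B = subst-< ≡.refl H≡1+B (s≤s (ℕₚ.≤-trans (toℕ-punchIn-≤ a (punchIn b y))
                                                       (subst-< (toℕ-punchIn-< b y y<B) ≡.refl y<B)))

  e-above : ∀ y → B ≤ toℕ y → H ≤ toℕ (e y)
  e-above y B≤y = ℕₚ.≤-trans (ℕₚ.≤-reflexive H≡1+B)
    (ℕₚ.≤-trans (s≤s B≤y)
      (ℕₚ.≤-trans (ℕₚ.≤-reflexive (≡.sym (toℕ-punchIn-≥ b y B≤y))) (≤-toℕ-punchIn a (punchIn b y))))

  e-below⁻¹ : ∀ y → toℕ (e y) < H → toℕ y < B
  e-below⁻¹ y ey<H = ℕₚ.≰⇒> (λ B≤y → ℕₚ.<⇒≱ ey<H (e-above y B≤y))

  view : ∀ k → k ≡ a ⊎ k ≡ top ⊎ Σ[ x ∈ Fin M ] k ≡ e x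
  view k with punchIn-view a k
  ... | inj₁ a≡k = inj₁ (≡.sym a≡k)
  ... | inj₂ (z , ≡.refl) with punchIn-view b z
  ...   | inj₁ ≡.refl = inj₂ (inj₁ ≡.refl)
  ...   | inj₂ (x , ≡.refl) = inj₂ (inj₂ (x , ≡.refl))

  module Remove (f : Fin (suc (suc M)) → Fin (suc (suc M))) (f-inv : Involutive f) (f-open : OpenPrefix H f)
                (f-top : f top ≡ a) where
    g : Fin M → Fin M
    g = delete b (delete a f)

    f-a : f a ≡ top
    f-a = ≡.trans (cong f (≡.sym f-top)) (f-inv top)

    f∘e≡e∘g : ∀ x → f (e x) ≡ e (g x)
    f∘e≡e∘g x = ≡.sym (≡.trans (cong (punchIn a) (punchIn-delete b (delete a f) x b≢))
                               (punchIn-delete a f (punchIn b x) a≢))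
      where
      a≢ : a ≢ f (e x)
      a≢ a≡ = punchInᵢ≢i b x (punchIn-injective a _ _ (≡.trans (≡.sym (f-inv (e x))) (≡.trans (cong f (≡.sym a≡)) f-a)))
      b≢ : b ≢ delete a f (punchIn b x)
      b≢ b≡ = punchInᵢ≢i a (punchIn b x) (≡.trans (≡.sym (f-inv (e x)))
                (≡.trans (cong f (≡.sym (≡.trans (cong (punchIn a) b≡) (punchIn-delete a f (punchIn b x) a≢)))) f-top))

    involutive : Involutive g
    involutive x = injective (≡.trans (≡.sym (f∘e≡e∘g (g x))) (≡.trans (cong f (≡.sym (f∘e≡e∘g x))) (f-inv (e x))))

    openPrefix : OpenPrefix B g
    openPrefix x x<B = ℕₚ.≮⇒≥ λ gx<B →
      ℕₚ.<⇒≱ (subst-< (cong toℕ (f∘e≡e∘g x)) ≡.refl (e-below (g x) gx<B)) (f-open (e x) (e-below x x<B))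

    restore : ∀ k → insert a top (insert b a (e ∘ g)) k ≡ f k
    restore k with view k
    ... | inj₁ ≡.refl = ≡.trans (insert-at a top _) (≡.sym f-a)
    ... | inj₂ (inj₁ ≡.refl) = ≡.trans (insert-punchIn a top _ b) (≡.trans (insert-at b a _) (≡.sym f-top))
    ... | inj₂ (inj₂ (x , ≡.refl)) = ≡.trans (insert-punchIn a top _ (punchIn b x))
                                             (≡.trans (insert-punchIn b a _ x) (≡.sym (f∘e≡e∘g x)))

    open Restriction f g f∘e≡e∘g

    fixedPoints-step : fixedPoints f ≡ fixedPoints g
    fixedPoints-step = ≡.trans (∑-remove₂ a b (λ i → iverson ⌊ f i ≟ i ⌋))
      (cong₂ ℕ._+_ (cong iverson (⌊⌋-false (f a ≟ a) (λ fa≡a → a≢top (≡.trans (≡.sym fa≡a) f-a))))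
        (cong₂ ℕ._+_ (cong iverson (⌊⌋-false (f top ≟ top) (λ ft≡t → a≢top (≡.trans (≡.sym f-top) ft≡t))))
          fixedPoints-restrict))

    excedances-step : excedances f ≡ suc (excedances g)
    excedances-step = ≡.trans (∑-remove₂ a b (λ i → iverson (toℕ i <ᵇ toℕ (f i))))
      (cong₂ ℕ._+_ (cong iverson (≡.trans (cong (λ k → A <ᵇ toℕ k) f-a) (<ᵇ-true A<H)))
        (cong₂ ℕ._+_ (cong iverson (≡.trans (cong (λ k → H <ᵇ toℕ k) f-top) (<ᵇ-false (ℕₚ.<⇒≤ A<H))))
          excedances-restrict))

    weakExcedances-step : weakExcedances f ≡ suc (weakExcedances g)
    weakExcedances-step = ≡.trans (∑-remove₂ a b (λ i → iverson (toℕ i ≤ᵇ toℕ (f i))))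
      (cong₂ ℕ._+_ (cong iverson (≡.trans (cong (λ k → A ≤ᵇ toℕ k) f-a) (≤ᵇ-true (ℕₚ.<⇒≤ A<H))))
        (cong₂ ℕ._+_ (cong iverson (≡.trans (cong (λ k → H ≤ᵇ toℕ k) f-top) (≤ᵇ-false A<H)))
          weakExcedances-restrict))

    private
      X₁ X₂ : ℕ
      X₁ = ∑ (λ x → inverted f (e x) a)
      X₂ = ∑ (λ x → inverted f (e x) top)

    inversions-split : inversions f ≡ ∑ (inverted f a) ℕ.+ (∑ (inverted f top) ℕ.+ (X₁ ℕ.+ (X₂ ℕ.+ inversions g)))
    inversions-split = ≡.trans (∑-remove₂ a b (λ i → ∑ (inverted f i)))
      (cong (λ z → ∑ (inverted f a) ℕ.+ (∑ (inverted f top) ℕ.+ z))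
        (≡.trans (sum-cong-≗ {M} (λ x → ∑-remove₂ a b (inverted f (e x))))
        (≡.trans (∑-distrib-+ (λ x → inverted f (e x) a)
                              (λ x → inverted f (e x) top ℕ.+ ∑ (λ y → inverted f (e x) (e y))))
          (cong (X₁ ℕ.+_) (≡.trans (∑-distrib-+ (λ x → inverted f (e x) top) (λ x → ∑ (λ y → inverted f (e x) (e y))))
            (cong (X₂ ℕ.+_) inversions-restrict))))))

    -- The arc accounts for H + 2A + (H − 1) inversions: the exponent of the A-th term of d_H.
    inversions-step : inversions f ≡ H ℕ.+ (A ℕ.+ (A ℕ.+ (B ℕ.+ inversions g)))
    inversions-step = ≡.trans inversions-split (cong₂ ℕ._+_ from-a (cong₂ ℕ._+_ from-top
                        (cong₂ (λ u w → u ℕ.+ (w ℕ.+ inversions g)) (≡.trans (≡.sym column-a) into-a) X₂≡B)))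
      where
      fa≡H : toℕ (f a) ≡ H
      fa≡H = cong toℕ f-a
      ftop≡A : toℕ (f top) ≡ A
      ftop≡A = cong toℕ f-top
      from-a : ∑ (inverted f a) ≡ H
      from-a = ≡.trans (∑-inverted-after f f-inv a λ k fk<fa → ℕₚ.<-≤-trans A<H
                 (ℕₚ.≤-trans (f-open (f k) (subst-< ≡.refl (≡.sym fa≡H) fk<fa)) (ℕₚ.≤-reflexive (cong toℕ (f-inv k)))))
               fa≡H
      from-top : ∑ (inverted f top) ≡ A
      from-top = ≡.trans (∑-inverted-after f f-inv top λ k fk<A →
                   ℕₚ.≤∧≢⇒< (ℕₚ.≤-trans (f-open (f k) (ℕₚ.<-trans (subst-< ≡.refl (≡.sym ftop≡A) fk<A) A<H))
                                      (ℕₚ.≤-reflexive (cong toℕ (f-inv k))))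
                           (λ H≡k → ℕₚ.<-irrefl (cong (toℕ ∘ f) (toℕ-injective (≡.sym H≡k))) fk<A))
                 ftop≡A
      into-a : ∑ (λ i → inverted f i a) ≡ A
      into-a = ∑-inverted-before f a λ i i<A → subst-< fa≡H ≡.refl (ℕₚ.≤∧≢⇒< (f-open i (ℕₚ.<-trans i<A A<H)) λ H≡fi →
                 ℕₚ.<-irrefl (cong toℕ (≡.trans (≡.sym (f-inv i)) (≡.trans (cong f (toℕ-injective (≡.sym H≡fi))) f-top))) i<A)
      into-top : ∑ (λ i → inverted f i top) ≡ H
      into-top = ∑-inverted-before f top λ i i<H → subst-< ftop≡A ≡.refl (ℕₚ.<-≤-trans A<H (f-open i i<H))
      column-a : ∑ (λ i → inverted f i a) ≡ X₁
      column-a = ≡.trans (∑-remove₂ a b (λ i → inverted f i a))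
        (cong₂ (λ u w → u ℕ.+ (w ℕ.+ X₁)) (inverted-diagonal f a)
               (cong (λ u → iverson (u ∧ (toℕ (f a) <ᵇ toℕ (f top)))) (<ᵇ-false (ℕₚ.<⇒≤ A<H))))
      column-top : ∑ (λ i → inverted f i top) ≡ suc X₂
      column-top = ≡.trans (∑-remove₂ a b (λ i → inverted f i top))
        (cong₂ (λ u w → u ℕ.+ (w ℕ.+ X₂))
               (cong iverson (cong₂ _∧_ (<ᵇ-true A<H) (≡.trans (cong₂ _<ᵇ_ ftop≡A fa≡H) (<ᵇ-true A<H))))
               (inverted-diagonal f top))
      X₂≡B : X₂ ≡ B
      X₂≡B = ℕₚ.suc-injective (≡.trans (≡.sym column-top) (≡.trans into-top H≡1+B))

  module Insert (g : Fin M → Fin M) (g-inv : Involutive g) (g-open : OpenPrefix B g) where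
    f : Fin (suc (suc M)) → Fin (suc (suc M))
    f = insert a top (insert b a (e ∘ g))

    f-a : f a ≡ top
    f-a = insert-at a top _

    f-top : f top ≡ a
    f-top = ≡.trans (insert-punchIn a top _ b) (insert-at b a _)

    f∘e≡e∘g : ∀ x → f (e x) ≡ e (g x)
    f∘e≡e∘g x = ≡.trans (insert-punchIn a top _ (punchIn b x)) (insert-punchIn b a _ x)

    involutive : Involutive f
    involutive k with view k
    ... | inj₁ ≡.refl = ≡.trans (cong f f-a) f-top
    ... | inj₂ (inj₁ ≡.refl) = ≡.trans (cong f f-top) f-a
    ... | inj₂ (inj₂ (x , ≡.refl)) = ≡.trans (cong f (f∘e≡e∘g x)) (≡.trans (f∘e≡e∘g (g x)) (cong e (g-inv x)))

    openPrefix : OpenPrefix H f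
    openPrefix k k<H with view k
    ... | inj₁ ≡.refl = ℕₚ.≤-reflexive (≡.sym (cong toℕ f-a))
    ... | inj₂ (inj₁ ≡.refl) = ⊥-elim (ℕₚ.<-irrefl ≡.refl k<H)
    ... | inj₂ (inj₂ (x , ≡.refl)) =
      ℕₚ.≤-trans (e-above (g x) (g-open x (e-below⁻¹ x k<H))) (ℕₚ.≤-reflexive (≡.sym (cong toℕ (f∘e≡e∘g x))))

    remove : ∀ x → delete b (delete a f) x ≡ g x
    remove x = injective (≡.trans (≡.sym (Remove.f∘e≡e∘g f involutive openPrefix f-top x)) (f∘e≡e∘g x))

_≡ᵛ_ : ∀ {n m} → Vec (Fin n) m → Vec (Fin n) m → Bool
[] ≡ᵛ [] = true
(x ∷ xs) ≡ᵛ (y ∷ ys) = ⌊ x ≟ y ⌋ ∧ (xs ≡ᵛ ys)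

≡ᵛ-sound : ∀ {n m} (u w : Vec (Fin n) m) → (u ≡ᵛ w) ≡ true → u ≡ w
≡ᵛ-sound [] [] _ = ≡.refl
≡ᵛ-sound (x ∷ xs) (y ∷ ys) eq with ∧-true⁻¹ {⌊ x ≟ y ⌋} eq
... | x≡ᵇy , xs≡ᵛys = cong₂ _∷_ (⌊⌋-true⁻¹ (x ≟ y) x≡ᵇy) (≡ᵛ-sound xs ys xs≡ᵛys)

≡ᵛ-refl : ∀ {n m} (u : Vec (Fin n) m) → (u ≡ᵛ u) ≡ true
≡ᵛ-refl [] = ≡.refl
≡ᵛ-refl (x ∷ xs) rewrite ⌊⌋-true (x ≟ x) ≡.refl = ≡ᵛ-refl xs

module ListSums {c ℓ} (R : CommutativeRing c ℓ) where
  open CommutativeRing R hiding (zero)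
  open import Relation.Binary.Reasoning.Setoid setoid
  open import Algebra.Properties.CommutativeSemigroup +-commutativeSemigroup using (interchange)

  listSum : ∀ {a} {A : Set a} → List A → (A → Carrier) → Carrier
  listSum L F = List.foldr _+_ 0# (List.map F L)

  module _ {a} {A : Set a} where

    listSum-cong : ∀ (L : List A) {F G : A → Carrier} → (∀ x → F x ≈ G x) → listSum L F ≈ listSum L G
    listSum-cong List.[] F≈G = refl
    listSum-cong (x List.∷ L) F≈G = +-cong (F≈G x) (listSum-cong L F≈G)

    listSum-zero : ∀ (L : List A) {F : A → Carrier} → (∀ x → F x ≈ 0#) → listSum L F ≈ 0#
    listSum-zero List.[] F≈0 = refl
    listSum-zero (x List.∷ L) F≈0 = trans (+-cong (F≈0 x) (listSum-zero L F≈0)) (+-identityˡ 0#)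

    listSum-distrib-+ : ∀ (L : List A) (F G : A → Carrier) → listSum L (λ x → F x + G x) ≈ listSum L F + listSum L G
    listSum-distrib-+ List.[] F G = sym (+-identityˡ 0#)
    listSum-distrib-+ (x List.∷ L) F G = trans (+-congˡ (listSum-distrib-+ L F G)) (interchange _ _ _ _)

    *-distribˡ-listSum : ∀ (L : List A) k (F : A → Carrier) → k * listSum L F ≈ listSum L (λ x → k * F x)
    *-distribˡ-listSum List.[] k F = zeroʳ k
    *-distribˡ-listSum (x List.∷ L) k F = trans (distribˡ k _ _) (+-congˡ (*-distribˡ-listSum L k F))

    listSum-++ : ∀ (L L′ : List A) (F : A → Carrier) → listSum (L List.++ L′) F ≈ listSum L F + listSum L′ F
    listSum-++ List.[] L′ F = sym (+-identityˡ _)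
    listSum-++ (x List.∷ L) L′ F = trans (+-congˡ (listSum-++ L L′ F)) (sym (+-assoc _ _ _))

    listSum-sumTo : ∀ (L : List A) (H : A → ℕ → Carrier) n →
      listSum L (λ x → sumTo R (H x) n) ≈ sumTo R (λ i → listSum L (λ x → H x i)) n
    listSum-sumTo L H zero = listSum-zero L (λ _ → refl)
    listSum-sumTo L H (suc n) = trans (listSum-distrib-+ L _ _) (+-congʳ (listSum-sumTo L H n))

  listSum-comm : ∀ {a b} {A : Set a} {B : Set b} (L : List A) (L′ : List B) (H : A → B → Carrier) →
    listSum L (λ x → listSum L′ (H x)) ≈ listSum L′ (λ y → listSum L (λ x → H x y))
  listSum-comm List.[] L′ H = sym (listSum-zero L′ (λ _ → refl))
  listSum-comm (x List.∷ L) L′ H = trans (+-congˡ (listSum-comm L L′ H)) (sym (listSum-distrib-+ L′ (H x) _))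

  listSum-map : ∀ {a b} {A : Set a} {B : Set b} (g : A → B) (L : List A) (F : B → Carrier) →
    listSum (List.map g L) F ≈ listSum L (F ∘ g)
  listSum-map g List.[] F = refl
  listSum-map g (x List.∷ L) F = +-congˡ (listSum-map g L F)

  listSum-concatMap : ∀ {a b} {A : Set a} {B : Set b} (k : A → List B) (L : List A) (F : B → Carrier) →
    listSum (concatMap k L) F ≈ listSum L (λ x → listSum (k x) F)
  listSum-concatMap k List.[] F = refl
  listSum-concatMap k (x List.∷ L) F = trans (listSum-++ (k x) (concatMap k L) F) (+-congˡ (listSum-concatMap k L F))

  listSum-tabulate-zero : ∀ {n k} (g : Fin n → Fin k) (F : Fin k → Carrier) → (∀ i → F (g i) ≈ 0#) →
    listSum (List.tabulate g) F ≈ 0#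
  listSum-tabulate-zero {zero} g F F∘g≈0 = refl
  listSum-tabulate-zero {suc n} g F F∘g≈0 =
    trans (+-cong (F∘g≈0 Fin.zero) (listSum-tabulate-zero (g ∘ Fin.suc) F (F∘g≈0 ∘ Fin.suc))) (+-identityˡ 0#)

  listSum-tabulate-δ : ∀ {n k} (g : Fin n → Fin k) → (∀ {x y} → g x ≡ g y → x ≡ y) → (F : Fin k → Carrier) (j : Fin n) →
    listSum (List.tabulate g) (λ i → if ⌊ i ≟ g j ⌋ then F i else 0#) ≈ F (g j)
  listSum-tabulate-δ {suc n} g g-inj F Fin.zero rewrite ⌊⌋-true (g Fin.zero ≟ g Fin.zero) ≡.refl =
    trans (+-congˡ (listSum-tabulate-zero (g ∘ Fin.suc) _ λ i → reflexive
            (cong (λ b → if b then F (g (Fin.suc i)) else 0#)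
                  (⌊⌋-false (g (Fin.suc i) ≟ g Fin.zero) λ e → 0≢1+n (≡.sym (g-inj e))))))
          (+-identityʳ _)
  listSum-tabulate-δ {suc n} g g-inj F (Fin.suc j) rewrite ⌊⌋-false (g Fin.zero ≟ g (Fin.suc j)) (λ e → 0≢1+n (g-inj e)) =
    trans (+-identityˡ _) (listSum-tabulate-δ (g ∘ Fin.suc) (λ e → suc-injective (g-inj e)) F j)

  listSum-allVecs-δ : ∀ n m (F : Vec (Fin n) m → Carrier) (c : Vec (Fin n) m) →
    listSum (allVecs n m) (λ u → if u ≡ᵛ c then F u else 0#) ≈ F c
  listSum-allVecs-δ n zero F [] = +-identityʳ _
  listSum-allVecs-δ n (suc m) F (j ∷ w₀) = begin
    listSum (concatMap (λ i → List.map (i ∷_) (allVecs n m)) (allFin n)) δ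
      ≈⟨ listSum-concatMap _ (allFin n) δ ⟩
    listSum (allFin n) (λ i → listSum (List.map (i ∷_) (allVecs n m)) δ)
      ≈⟨ listSum-cong (allFin n) (λ i → listSum-map (i ∷_) (allVecs n m) δ) ⟩
    listSum (allFin n) (λ i → listSum (allVecs n m) (λ w → δ (i ∷ w)))
      ≈⟨ listSum-cong (allFin n) tail-δ ⟩
    listSum (allFin n) (λ i → if ⌊ i ≟ j ⌋ then F (i ∷ w₀) else 0#)
      ≈⟨ listSum-tabulate-δ id id (λ i → F (i ∷ w₀)) j ⟩
    F (j ∷ w₀) ∎
    where
    δ : Vec (Fin n) (suc m) → Carrier
    δ u = if u ≡ᵛ (j ∷ w₀) then F u else 0#
    tail-δ : ∀ i → listSum (allVecs n m) (λ w → δ (i ∷ w)) ≈ (if ⌊ i ≟ j ⌋ then F (i ∷ w₀) else 0#)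
    tail-δ i with ⌊ i ≟ j ⌋
    ... | true = listSum-allVecs-δ n m (λ w → F (i ∷ w)) w₀
    ... | false = listSum-zero (allVecs n m) (λ _ → refl)

  -- Double counting over the pairs (a , b) with P a and b = φ a, equivalently Q b and a = ψ b.
  module Reindex {M N : ℕ} (φ : Vec (Fin M) M → Vec (Fin N) N) (ψ : Vec (Fin N) N → Vec (Fin M) M)
                 (P : Vec (Fin M) M → Bool) (Q : Vec (Fin N) N → Bool)
                 (φ-Q : ∀ a → P a ≡ true → Q (φ a) ≡ true) (ψ∘φ : ∀ a → P a ≡ true → ψ (φ a) ≡ a)
                 (ψ-P : ∀ b → Q b ≡ true → P (ψ b) ≡ true) (φ∘ψ : ∀ b → Q b ≡ true → φ (ψ b) ≡ b) where

    private
      false≢true : false ≢ true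
      false≢true ()

    matched : ∀ (g : Vec (Fin N) N → Carrier) a b →
      (if P a then (if b ≡ᵛ φ a then g b else 0#) else 0#) ≈ (if a ≡ᵛ ψ b then (if Q b then g b else 0#) else 0#)
    matched g a b with P a in Pa | b ≡ᵛ φ a in b≡φa | a ≡ᵛ ψ b in a≡ψb | Q b in Qb
    ... | true  | true  | true  | true  = refl
    ... | true  | true  | true  | false = ⊥-elim (false≢true (≡.trans (≡.sym Qb)
                                            (≡.trans (cong Q (≡ᵛ-sound _ _ b≡φa)) (φ-Q a Pa))))
    ... | true  | true  | false | _     = ⊥-elim (false≢true (≡.trans (≡.sym a≡ψb)
                                            (≡.trans (cong (λ z → a ≡ᵛ ψ z) (≡ᵛ-sound _ _ b≡φa))
                                                     (≡.trans (cong (a ≡ᵛ_) (ψ∘φ a Pa)) (≡ᵛ-refl a)))))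
    ... | true  | false | true  | true  = ⊥-elim (false≢true (≡.trans (≡.sym b≡φa)
                                            (≡.trans (cong (λ z → b ≡ᵛ φ z) (≡ᵛ-sound _ _ a≡ψb))
                                                     (≡.trans (cong (b ≡ᵛ_) (φ∘ψ b Qb)) (≡ᵛ-refl b)))))
    ... | true  | false | true  | false = refl
    ... | true  | false | false | _     = refl
    ... | false | _     | true  | true  = ⊥-elim (false≢true (≡.trans (≡.sym Pa)
                                            (≡.trans (cong P (≡ᵛ-sound _ _ a≡ψb)) (ψ-P b Qb))))
    ... | false | _     | true  | false = refl
    ... | false | _     | false | _     = refl

    reindex : ∀ (f : Vec (Fin M) M → Carrier) (g : Vec (Fin N) N → Carrier) → (∀ a → P a ≡ true → f a ≈ g (φ a)) →
      listSum (allMaps M) (λ a → if P a then f a else 0#) ≈ listSum (allMaps N) (λ b → if Q b then g b else 0#)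
    reindex f g f≈g∘φ = begin
      listSum (allMaps M) (λ a → if P a then f a else 0#)
        ≈⟨ listSum-cong (allMaps M) expand ⟩
      listSum (allMaps M) (λ a → listSum (allMaps N) (pairs a))
        ≈⟨ listSum-comm (allMaps M) (allMaps N) pairs ⟩
      listSum (allMaps N) (λ b → listSum (allMaps M) (λ a → pairs a b))
        ≈⟨ listSum-cong (allMaps N) (λ b → trans (listSum-cong (allMaps M) (λ a → matched g a b))
                                                 (listSum-allVecs-δ M M (λ _ → if Q b then g b else 0#) (ψ b))) ⟩
      listSum (allMaps N) (λ b → if Q b then g b else 0#) ∎
      where
      pairs : Vec (Fin M) M → Vec (Fin N) N → Carrier
      pairs a b = if P a then (if b ≡ᵛ φ a then g b else 0#) else 0#
      expand : ∀ a → (if P a then f a else 0#) ≈ listSum (allMaps N) (pairs a)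
      expand a with P a in Pa
      ... | true = trans (f≈g∘φ a Pa) (sym (listSum-allVecs-δ N N g (φ a)))
      ... | false = sym (listSum-zero (allMaps N) (λ _ → refl))

openPrefix? : ∀ {n} h (f : Fin n → Fin n) → Dec (OpenPrefix h f)
openPrefix? h f = all? (λ i → (toℕ i ℕ.<? h) →-dec (h ℕ.≤? toℕ (f i)))
  where open import Data.Fin.Properties using (all?)
        open import Relation.Nullary.Decidable using (_→-dec_)

⌊toℕ≟toℕ⌋ : ∀ {n} (i k : Fin n) → ⌊ toℕ i ℕₚ.≟ toℕ k ⌋ ≡ ⌊ i ≟ k ⌋
⌊toℕ≟toℕ⌋ i k with i ≟ k
... | yes i≡k = ⌊⌋-true (toℕ i ℕₚ.≟ toℕ k) (cong toℕ i≡k)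
... | no i≢k = ⌊⌋-false (toℕ i ℕₚ.≟ toℕ k) (i≢k ∘ toℕ-injective)

fixedPoint-exponent : ∀ h i → h ℕ.+ (h ℕ.+ i) ≡ 2 ℕ.* h ℕ.+ i
fixedPoint-exponent = solve-∀
  where open import Data.Nat.Tactic.RingSolver using (solve-∀)

arc-inversions-regroup : ∀ h a b i → h ℕ.+ (a ℕ.+ (a ℕ.+ (b ℕ.+ i))) ≡ h ℕ.+ (a ℕ.+ (a ℕ.+ b)) ℕ.+ i
arc-inversions-regroup = solve-∀
  where open import Data.Nat.Tactic.RingSolver using (solve-∀)

-- 2 * suc h ∸ 1 computes to h + suc (h + 0), so a semiring identity suffices.
arc-exponent : ∀ h a → suc h ℕ.+ (a ℕ.+ (a ℕ.+ h)) ≡ (2 ℕ.* suc h ∸ 1) ℕ.+ 2 ℕ.* a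
arc-exponent = semiring-form
  where
  open import Data.Nat.Tactic.RingSolver using (solve-∀)
  semiring-form : ∀ h a → suc h ℕ.+ (a ℕ.+ (a ℕ.+ h)) ≡ h ℕ.+ suc (h ℕ.+ 0) ℕ.+ (a ℕ.+ (a ℕ.+ 0))
  semiring-form = solve-∀

admissible : ∀ {n} → ℕ → Vec (Fin n) n → Bool
admissible h π = isInvolution π ∧ ⌊ openPrefix? h (app π) ⌋

admissible⁻ : ∀ {n} h (π : Vec (Fin n) n) → admissible h π ≡ true → Involutive (app π) × OpenPrefix h (app π)
admissible⁻ h π adm with ∧-true⁻¹ {isInvolution π} adm
... | inv , open′ = isInvolution⇒Involutive π inv , ⌊⌋-true⁻¹ (openPrefix? h (app π)) open′

admissible⁺ : ∀ {n} h (π : Vec (Fin n) n) → Involutive (app π) → OpenPrefix h (app π) → admissible h π ≡ true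
admissible⁺ h π π-inv π-open =
  cong₂ _∧_ (Involutive⇒isInvolution π π-inv) (⌊⌋-true (openPrefix? h (app π)) π-open)

admissible-tabulate : ∀ {n} h (g : Fin n → Fin n) → Involutive g → OpenPrefix h g → admissible h (tabulate g) ≡ true
admissible-tabulate h g g-inv g-open = admissible⁺ h (tabulate g)
  (λ i → ≡.trans (lookup∘tabulate g _) (≡.trans (cong g (lookup∘tabulate g i)) (g-inv i)))
  (λ i i<h → ≡.subst (h ≤_) (cong toℕ (≡.sym (lookup∘tabulate g i))) (g-open i i<h))

openPrefix-pred : ∀ {n} (f : Fin n → Fin n) h → OpenPrefix (suc h) f → OpenPrefix h f
openPrefix-pred f h f-open i i<h = ℕₚ.≤-trans (ℕₚ.n≤1+n h) (f-open i (ℕₚ.m<n⇒m<1+n i<h))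

openPrefix-suc : ∀ {n} (f : Fin n → Fin n) (j : Fin n) → Involutive f → OpenPrefix (toℕ j) f →
  toℕ j < toℕ (f j) → OpenPrefix (suc (toℕ j)) f
openPrefix-suc f j f-inv f-open j<fj i i<1+j with ℕₚ.m<1+n⇒m<n∨m≡n i<1+j
... | inj₂ i≡j rewrite toℕ-injective {i = i} {j = j} i≡j = j<fj
... | inj₁ i<j = ℕₚ.≤∧≢⇒< (f-open i i<j) λ j≡fi →
  ℕₚ.<-irrefl (cong toℕ (≡.trans (≡.sym (f-inv i)) (cong f (toℕ-injective {i = f i} {j = j} (≡.sym j≡fi)))))
              (ℕₚ.<-trans i<j j<fj)

admissible-pred : ∀ {n} h (π : Vec (Fin n) n) → admissible (suc h) π ≡ true → admissible h π ≡ true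
admissible-pred h π adm with admissible⁻ (suc h) π adm
... | π-inv , π-open = admissible⁺ h π π-inv (openPrefix-pred (app π) h π-open)

module InvolutionSums {c ℓ} (R : CommutativeRing c ℓ) (x v t q : CommutativeRing.Carrier R) where
  open CommutativeRing R hiding (zero)
  open import Relation.Binary.Reasoning.Setoid setoid
  open FiniteSums R using (sumTo-zero; sumTo-cong<; *-distribˡ-sumTo; *-distribʳ-sumTo; sumTo-δ; sumTo-δ-zero)
  open ListSums R

  infixr 8 _^_
  _^_ : Carrier → ℕ → Carrier
  _^_ = pow R

  ^-+ : ∀ a m n → a ^ (m ℕ.+ n) ≈ a ^ m * a ^ n
  ^-+ a zero n = sym (*-identityˡ _)
  ^-+ a (suc m) n = trans (*-congˡ (^-+ a m n)) (sym (*-assoc _ _ _))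

  weight : ∀ {n} → Vec (Fin n) n → Carrier
  weight π = x ^ fp π * v ^ exc π * t ^ cyc π * q ^ inv π

  weightᶠ : ∀ {n} → (Fin n → Fin n) → Carrier
  weightᶠ f = x ^ fixedPoints f * v ^ excedances f * t ^ weakExcedances f * q ^ inversions f

  weight≈weightᶠ : ∀ {n} (π : Vec (Fin n) n) → Involutive (app π) → weight π ≈ weightᶠ (app π)
  weight≈weightᶠ π π-inv = reflexive (cong₂ _*_ (cong₂ _*_ (cong₂ _*_ (cong (x ^_) (fp≡fixedPoints π))
    (cong (v ^_) (exc≡excedances π))) (cong (t ^_) (cyc≡weakExcedances π π-inv))) (cong (q ^_) (inv≡inversions π)))

  weightᶠ-cong : ∀ {n} {f f′ : Fin n → Fin n} → (∀ i → f i ≡ f′ i) → weightᶠ f ≈ weightᶠ f′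
  weightᶠ-cong {n} f≗f′ = reflexive (cong₂ _*_ (cong₂ _*_ (cong₂ _*_
    (cong (x ^_) (sum-cong-≗ {n} (λ i → cong (λ z → iverson ⌊ z ≟ i ⌋) (f≗f′ i))))
    (cong (v ^_) (sum-cong-≗ {n} (λ i → cong (λ z → iverson (toℕ i <ᵇ toℕ z)) (f≗f′ i)))))
    (cong (t ^_) (sum-cong-≗ {n} (λ i → cong (λ z → iverson (toℕ i ≤ᵇ toℕ z)) (f≗f′ i)))))
    (cong (q ^_) (sum-cong-≗ {n} (λ i → sum-cong-≗ {n} (λ k →
      cong₂ (λ u w → iverson ((toℕ i <ᵇ toℕ k) ∧ (toℕ u <ᵇ toℕ w))) (f≗f′ k) (f≗f′ i))))))

  involSum : ℕ → ℕ → Carrier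
  involSum N h = listSum (allMaps N) (λ π → if admissible h π then weight π else 0#)

  *-if : ∀ k b w → k * (if b then w else 0#) ≈ (if b then k * w else 0#)
  *-if k true w = refl
  *-if k false w = zeroʳ k

  module Reduction {K M : ℕ} (h h′ : ℕ) (selected : (Fin K → Fin K) → Bool)
    (selected-cong : ∀ {f f′} → (∀ k → f k ≡ f′ k) → selected f ≡ selected f′)
    (remove : (Fin K → Fin K) → Fin M → Fin M) (restore : (Fin M → Fin M) → Fin K → Fin K) (factor : Carrier)
    (remove-cong : ∀ {f f′} → (∀ k → f k ≡ f′ k) → ∀ y → remove f y ≡ remove f′ y)
    (restore-cong : ∀ {g g′} → (∀ y → g y ≡ g′ y) → ∀ k → restore g k ≡ restore g′ k)
    (remove-involutive : ∀ f → Involutive f → OpenPrefix h f → selected f ≡ true → Involutive (remove f))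
    (remove-open : ∀ f → Involutive f → OpenPrefix h f → selected f ≡ true → OpenPrefix h′ (remove f))
    (restore∘remove : ∀ f → Involutive f → OpenPrefix h f → selected f ≡ true → ∀ k → restore (remove f) k ≡ f k)
    (weight-remove : ∀ f → Involutive f → OpenPrefix h f → selected f ≡ true → weightᶠ f ≈ factor * weightᶠ (remove f))
    (restore-involutive : ∀ g → Involutive g → OpenPrefix h′ g → Involutive (restore g))
    (restore-open : ∀ g → Involutive g → OpenPrefix h′ g → OpenPrefix h (restore g))
    (restore-selected : ∀ g → Involutive g → OpenPrefix h′ g → selected (restore g) ≡ true)
    (remove∘restore : ∀ g → Involutive g → OpenPrefix h′ g → ∀ y → remove (restore g) y ≡ g y) where

    private
      φ : Vec (Fin K) K → Vec (Fin M) M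
      φ π = tabulate (remove (app π))
      ψ : Vec (Fin M) M → Vec (Fin K) K
      ψ σ = tabulate (restore (app σ))
      P : Vec (Fin K) K → Bool
      P π = admissible h π ∧ selected (app π)

      P⁻ : ∀ π → P π ≡ true → Involutive (app π) × OpenPrefix h (app π) × selected (app π) ≡ true
      P⁻ π Pπ with ∧-true⁻¹ {admissible h π} Pπ
      ... | adm , sel = proj₁ (admissible⁻ h π adm) , proj₂ (admissible⁻ h π adm) , sel

      φ-admissible : ∀ π → P π ≡ true → admissible h′ (φ π) ≡ true
      φ-admissible π Pπ with P⁻ π Pπ
      ... | inv′ , open′ , sel = admissible-tabulate h′ _ (remove-involutive _ inv′ open′ sel) (remove-open _ inv′ open′ sel)

      ψ∘φ : ∀ π → P π ≡ true → ψ (φ π) ≡ π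
      ψ∘φ π Pπ with P⁻ π Pπ
      ... | inv′ , open′ , sel = ≡.trans (tabulate-cong λ k →
              ≡.trans (restore-cong (lookup∘tabulate (remove (app π))) k) (restore∘remove _ inv′ open′ sel k))
            (tabulate∘lookup π)

      ψ-P : ∀ σ → admissible h′ σ ≡ true → P (ψ σ) ≡ true
      ψ-P σ adm with admissible⁻ h′ σ adm
      ... | inv′ , open′ = cong₂ _∧_ (admissible-tabulate h _ (restore-involutive _ inv′ open′) (restore-open _ inv′ open′))
                                     (≡.trans (selected-cong (lookup∘tabulate (restore (app σ)))) (restore-selected _ inv′ open′))

      φ∘ψ : ∀ σ → admissible h′ σ ≡ true → φ (ψ σ) ≡ σ
      φ∘ψ σ adm with admissible⁻ h′ σ adm
      ... | inv′ , open′ = ≡.trans (tabulate-cong λ y →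
              ≡.trans (remove-cong (lookup∘tabulate (restore (app σ))) y) (remove∘restore _ inv′ open′ y))
            (tabulate∘lookup σ)

      weight-φ : ∀ π → P π ≡ true → weight π ≈ factor * weight (φ π)
      weight-φ π Pπ with P⁻ π Pπ
      ... | inv′ , open′ , sel = begin
        weight π                         ≈⟨ weight≈weightᶠ π inv′ ⟩
        weightᶠ (app π)                  ≈⟨ weight-remove _ inv′ open′ sel ⟩
        factor * weightᶠ (remove (app π)) ≈⟨ *-congˡ (weightᶠ-cong (lookup∘tabulate (remove (app π)))) ⟨
        factor * weightᶠ (app (φ π))      ≈⟨ *-congˡ (weight≈weightᶠ (φ π) (proj₁ (admissible⁻ h′ (φ π) (φ-admissible π Pπ)))) ⟨
        factor * weight (φ π)            ∎

    reduce : listSum (allMaps K) (λ π → if admissible h π ∧ selected (app π) then weight π else 0#) ≈ factor * involSum M h′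
    reduce = begin
      listSum (allMaps K) (λ π → if P π then weight π else 0#)
        ≈⟨ Reindex.reindex φ ψ P (admissible h′) φ-admissible ψ∘φ ψ-P φ∘ψ weight (λ σ → factor * weight σ) weight-φ ⟩
      listSum (allMaps M) (λ σ → if admissible h′ σ then factor * weight σ else 0#)
        ≈⟨ listSum-cong (allMaps M) (λ σ → *-if factor (admissible h′ σ) (weight σ)) ⟨
      listSum (allMaps M) (λ σ → factor * (if admissible h′ σ then weight σ else 0#))
        ≈⟨ *-distribˡ-listSum (allMaps M) factor _ ⟨
      factor * involSum M h′ ∎

  private
    ℓ-regroup : ∀ a b X V C Q I → (a * X) * V * (b * C) * (Q * I) ≈ (a * b * Q) * (X * V * C * I)
    ℓ-regroup = solve 7 (λ a b X V C Q I →
      (((a ⊕ X) ⊕ V) ⊕ (b ⊕ C)) ⊕ (Q ⊕ I) ⊜ ((a ⊕ b) ⊕ Q) ⊕ (((X ⊕ V) ⊕ C) ⊕ I)) refl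
      where open import Algebra.Solver.CommutativeMonoid *-commutativeMonoid using (solve; _⊜_; _⊕_)

    d-regroup : ∀ a b X V C Q I → X * (a * V) * (b * C) * (Q * I) ≈ (a * b * Q) * (X * V * C * I)
    d-regroup = solve 7 (λ a b X V C Q I →
      ((X ⊕ (a ⊕ V)) ⊕ (b ⊕ C)) ⊕ (Q ⊕ I) ⊜ ((a ⊕ b) ⊕ Q) ⊕ (((X ⊕ V) ⊕ C) ⊕ I)) refl
      where open import Algebra.Solver.CommutativeMonoid *-commutativeMonoid using (solve; _⊜_; _⊕_)

  fixedPointCase : ∀ N (j : Fin (suc N)) →
    listSum (allMaps (suc N)) (λ π → if admissible (toℕ j) π ∧ ⌊ app π j ≟ j ⌋ then weight π else 0#)
      ≈ lSeq R x t q (toℕ j) * involSum N (toℕ j)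
  fixedPointCase N j = Reduction.reduce h h (λ f → ⌊ f j ≟ j ⌋) (λ f≗f′ → cong (λ z → ⌊ z ≟ j ⌋) (f≗f′ j))
    (delete j) (λ g → insert j j (punchIn j ∘ g)) (lSeq R x t q h)
    (delete-cong j) (λ g≗g′ → insert-cong j j (λ y → cong (punchIn j) (g≗g′ y)))
    (λ f f-inv f-open sel → Remove.involutive f f-inv f-open (fixed f sel))
    (λ f f-inv f-open sel → Remove.openPrefix f f-inv f-open (fixed f sel))
    (λ f f-inv f-open sel → Remove.restore f f-inv f-open (fixed f sel))
    weight-remove
    Insert.involutive Insert.openPrefix
    (λ g g-inv g-open → ⌊⌋-true (Insert.f g g-inv g-open j ≟ j) (Insert.fj≡j g g-inv g-open))
    Insert.remove
    where
    open FixedPointRemoval j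
    h = toℕ j
    fixed : ∀ (f : Fin (suc N) → Fin (suc N)) → ⌊ f j ≟ j ⌋ ≡ true → f j ≡ j
    fixed f = ⌊⌋-true⁻¹ (f j ≟ j)
    weight-remove : ∀ f → Involutive f → OpenPrefix h f → ⌊ f j ≟ j ⌋ ≡ true →
                    weightᶠ f ≈ lSeq R x t q h * weightᶠ (delete j f)
    weight-remove f f-inv f-open sel = begin
      weightᶠ f
        ≈⟨ reflexive (cong₂ _*_ (cong₂ _*_ (cong₂ _*_ (cong (x ^_) fixedPoints-step) (cong (v ^_) excedances-step))
                       (cong (t ^_) weakExcedances-step)) (cong (q ^_) (≡.trans inversions-step (fixedPoint-exponent h _)))) ⟩
      (x * x ^ fixedPoints g) * v ^ excedances g * (t * t ^ weakExcedances g) * q ^ (2 ℕ.* h ℕ.+ inversions g)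
        ≈⟨ *-congˡ (^-+ q (2 ℕ.* h) _) ⟩
      (x * x ^ fixedPoints g) * v ^ excedances g * (t * t ^ weakExcedances g) * (q ^ (2 ℕ.* h) * q ^ inversions g)
        ≈⟨ ℓ-regroup x t _ _ _ _ _ ⟩
      lSeq R x t q h * weightᶠ g ∎
      where open Remove f f-inv f-open (fixed f sel)

  arcReduction : ∀ M (a : Fin (suc (suc M))) (b : Fin (suc M)) (a≤b : toℕ a ≤ toℕ b) →
    let top = punchIn a b in
    listSum (allMaps (suc (suc M))) (λ π → if admissible (toℕ top) π ∧ ⌊ app π top ≟ a ⌋ then weight π else 0#)
      ≈ (v * t * q ^ (toℕ top ℕ.+ (toℕ a ℕ.+ (toℕ a ℕ.+ toℕ b)))) * involSum M (toℕ b)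
  arcReduction M a b a≤b = Reduction.reduce H B (λ f → ⌊ f top ≟ a ⌋) (λ f≗f′ → cong (λ z → ⌊ z ≟ a ⌋) (f≗f′ top))
    (λ f → delete b (delete a f)) (λ g → insert a top (insert b a (punchIn a ∘ punchIn b ∘ g))) (v * t * q ^ E)
    (λ f≗f′ y → delete-cong b (delete-cong a f≗f′) y)
    (λ g≗g′ → insert-cong a top (insert-cong b a (λ y → cong (punchIn a ∘ punchIn b) (g≗g′ y))))
    (λ f f-inv f-open sel → Remove.involutive f f-inv f-open (closes f sel))
    (λ f f-inv f-open sel → Remove.openPrefix f f-inv f-open (closes f sel))
    (λ f f-inv f-open sel → Remove.restore f f-inv f-open (closes f sel))
    weight-remove
    Insert.involutive Insert.openPrefix
    (λ g g-inv g-open → ⌊⌋-true (Insert.f g g-inv g-open top ≟ a) (Insert.f-top g g-inv g-open))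
    Insert.remove
    where
    open ArcRemoval a b a≤b
    H = toℕ top
    B = toℕ b
    E = H ℕ.+ (toℕ a ℕ.+ (toℕ a ℕ.+ B))
    closes : ∀ (f : Fin (suc (suc M)) → Fin (suc (suc M))) → ⌊ f top ≟ a ⌋ ≡ true → f top ≡ a
    closes f = ⌊⌋-true⁻¹ (f top ≟ a)
    weight-remove : ∀ f → Involutive f → OpenPrefix H f → ⌊ f top ≟ a ⌋ ≡ true →
                    weightᶠ f ≈ (v * t * q ^ E) * weightᶠ (delete b (delete a f))
    weight-remove f f-inv f-open sel = begin
      weightᶠ f
        ≈⟨ reflexive (cong₂ _*_ (cong₂ _*_ (cong₂ _*_ (cong (x ^_) fixedPoints-step) (cong (v ^_) excedances-step))
                       (cong (t ^_) weakExcedances-step))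
                       (cong (q ^_) (≡.trans inversions-step (arc-inversions-regroup H (toℕ a) B (inversions g))))) ⟩
      x ^ fixedPoints g * (v * v ^ excedances g) * (t * t ^ weakExcedances g) * q ^ (E ℕ.+ inversions g)
        ≈⟨ *-congˡ (^-+ q E _) ⟩
      x ^ fixedPoints g * (v * v ^ excedances g) * (t * t ^ weakExcedances g) * (q ^ E * q ^ inversions g)
        ≈⟨ d-regroup v t _ _ _ _ _ ⟩
      (v * t * q ^ E) * weightᶠ g ∎
      where
      open Remove f f-inv f-open (closes f sel)

  arcWeight : ℕ → ℕ → Carrier
  arcWeight h a = v * t * q ^ (2 ℕ.* h ∸ 1) * q ^ (2 ℕ.* a)

  closing : ∀ N → Fin (suc N) → ℕ → Carrier
  closing N j a =
    listSum (allMaps (suc N)) (λ π → if admissible (toℕ j) π ∧ ⌊ toℕ (app π j) ℕₚ.≟ a ⌋ then weight π else 0#)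

  arcCase : ∀ M (j : Fin (suc (suc M))) h → toℕ j ≡ suc h → ∀ a → a < suc h →
    closing (suc M) j a ≈ arcWeight (suc h) a * involSum M h
  arcCase M j h j≡1+h a a<1+h = begin
    closing (suc M) j a
      ≈⟨ listSum-cong (allMaps (suc (suc M))) (λ π → reflexive (cong (λ b → if b then weight π else 0#) (selector π))) ⟩
    listSum (allMaps (suc (suc M))) (λ π → if admissible H π ∧ ⌊ app π top ≟ aᶠ ⌋ then weight π else 0#)
      ≈⟨ arcReduction M aᶠ bᶠ a≤b ⟩
    (v * t * q ^ (H ℕ.+ (A ℕ.+ (A ℕ.+ B)))) * involSum M B
      ≈⟨ *-cong factor (reflexive (cong (involSum M) B≡h)) ⟩
    arcWeight (suc h) a * involSum M h ∎
    where
    1+h<2+M : suc h < suc (suc M)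
    1+h<2+M = ≡.subst (_< suc (suc M)) j≡1+h (toℕ<n j)
    aᶠ : Fin (suc (suc M))
    aᶠ = fromℕ< (ℕₚ.<-trans a<1+h 1+h<2+M)
    bᶠ : Fin (suc M)
    bᶠ = fromℕ< (ℕₚ.≤-pred 1+h<2+M)
    top = punchIn aᶠ bᶠ
    A = toℕ aᶠ
    B = toℕ bᶠ
    H = toℕ top
    A≡a : A ≡ a
    A≡a = toℕ-fromℕ< _
    B≡h : B ≡ h
    B≡h = toℕ-fromℕ< _
    a≤b : A ≤ B
    a≤b = ≡.subst₂ _≤_ (≡.sym A≡a) (≡.sym B≡h) (ℕₚ.≤-pred a<1+h)
    H≡1+h : H ≡ suc h
    H≡1+h = ≡.trans (toℕ-punchIn-≥ aᶠ bᶠ a≤b) (cong suc B≡h)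
    j≡top : j ≡ top
    j≡top = toℕ-injective (≡.trans j≡1+h (≡.sym H≡1+h))
    selector : ∀ π → (admissible (toℕ j) π ∧ ⌊ toℕ (app π j) ℕₚ.≟ a ⌋) ≡ (admissible H π ∧ ⌊ app π top ≟ aᶠ ⌋)
    selector π = ≡.trans (cong (λ k → admissible (toℕ k) π ∧ ⌊ toℕ (app π k) ℕₚ.≟ a ⌋) j≡top)
      (cong (admissible H π ∧_) (≡.trans (cong (λ z → ⌊ toℕ (app π top) ℕₚ.≟ z ⌋) (≡.sym A≡a)) (⌊toℕ≟toℕ⌋ (app π top) aᶠ)))
    factor : v * t * q ^ (H ℕ.+ (A ℕ.+ (A ℕ.+ B))) ≈ arcWeight (suc h) a
    factor = trans (*-congˡ (reflexive (cong (q ^_)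
                     (≡.trans (cong₂ ℕ._+_ H≡1+h (cong₂ ℕ._+_ A≡a (cong₂ ℕ._+_ A≡a B≡h))) (arc-exponent h a)))))
                   (trans (*-congˡ (^-+ q (2 ℕ.* suc h ∸ 1) (2 ℕ.* a))) (sym (*-assoc _ _ _)))

  closingSum : ∀ M (j : Fin (suc (suc M))) h → toℕ j ≡ suc h →
    sumTo R (closing (suc M) j) (suc h) ≈ dSeq R v t q (suc h) * involSum M h
  closingSum M j h j≡1+h = begin
    sumTo R (closing (suc M) j) (suc h)
      ≈⟨ sumTo-cong< (suc h) (arcCase M j h j≡1+h) ⟩
    sumTo R (λ a → arcWeight (suc h) a * involSum M h) (suc h)
      ≈⟨ *-distribʳ-sumTo (involSum M h) _ (suc h) ⟨
    sumTo R (arcWeight (suc h)) (suc h) * involSum M h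
      ≈⟨ *-congʳ (*-distribˡ-sumTo _ _ (suc h)) ⟨
    dSeq R v t q (suc h) * involSum M h ∎

  module Decomposition (N : ℕ) (j : Fin (suc N)) where
    private
      h = toℕ j

    admissible-suc-false : ∀ (π : Vec (Fin (suc N)) (suc N)) → admissible h π ≡ false → admissible (suc h) π ≡ false
    admissible-suc-false π ¬adm with admissible (suc h) π in adm
    ... | false = ≡.refl
    ... | true = ≡.trans (≡.sym (admissible-pred h π adm)) ¬adm

    not-admissible-suc : ∀ (π : Vec (Fin (suc N)) (suc N)) → toℕ (app π j) ≤ h → admissible (suc h) π ≡ false
    not-admissible-suc π πj≤h with admissible (suc h) π in adm
    ... | false = ≡.refl
    ... | true = ⊥-elim (ℕₚ.<-irrefl ≡.refl (ℕₚ.<-≤-trans (proj₂ (admissible⁻ (suc h) π adm) j ℕₚ.≤-refl) πj≤h))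

    -- At position h an admissible involution has a fixed point, opens an arc, or closes
    -- the arc opened at some a < h.
    split : ∀ (π : Vec (Fin (suc N)) (suc N)) →
      (if admissible h π then weight π else 0#) ≈
      ((if admissible h π ∧ ⌊ app π j ≟ j ⌋ then weight π else 0#) +
       ((if admissible (suc h) π then weight π else 0#) +
        sumTo R (λ a → if admissible h π ∧ ⌊ toℕ (app π j) ℕₚ.≟ a ⌋ then weight π else 0#) h))
    split π with admissible h π in adm
    ... | false rewrite admissible-suc-false π adm =
      sym (trans (+-identityˡ _) (trans (+-identityˡ _) (sumTo-zero h (λ _ _ → refl))))
    ... | true with ℕₚ.<-cmp (toℕ (app π j)) h
    ...   | tri≈ _ πj≡h _ rewrite ⌊⌋-true (app π j ≟ j) (toℕ-injective πj≡h) | not-admissible-suc π (ℕₚ.≤-reflexive πj≡h) =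
      sym (trans (+-congˡ (trans (+-identityˡ _) (sumTo-δ-zero (weight π) _ h (ℕₚ.≤-reflexive (≡.sym πj≡h))))) (+-identityʳ _))
    ...   | tri< πj<h _ _ rewrite ⌊⌋-false (app π j ≟ j) (λ πj≡j → ℕₚ.<-irrefl (cong toℕ πj≡j) πj<h)
                              | not-admissible-suc π (ℕₚ.<⇒≤ πj<h) =
      sym (trans (+-identityˡ _) (trans (+-identityˡ _) (sumTo-δ (weight π) _ h πj<h)))
    ...   | tri> _ _ h<πj rewrite ⌊⌋-false (app π j ≟ j) (λ πj≡j → ℕₚ.<-irrefl (cong toℕ (≡.sym πj≡j)) h<πj)
                              | admissible⁺ (suc h) π (proj₁ (admissible⁻ h π adm))
                                  (openPrefix-suc (app π) j (proj₁ (admissible⁻ h π adm)) (proj₂ (admissible⁻ h π adm)) h<πj) =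
      sym (trans (+-identityˡ _) (trans (+-congˡ (sumTo-δ-zero (weight π) _ h (ℕₚ.<⇒≤ h<πj))) (+-identityʳ _)))

    involSum-step : involSum (suc N) h ≈ lSeq R x t q h * involSum N h + (involSum (suc N) (suc h) + sumTo R (closing N j) h)
    involSum-step = begin
      involSum (suc N) h
        ≈⟨ listSum-cong (allMaps (suc N)) split ⟩
      listSum (allMaps (suc N)) (λ π → fixedTerm π + (openingTerm π + sumTo R (closingTerm π) h))
        ≈⟨ listSum-distrib-+ (allMaps (suc N)) _ _ ⟩
      listSum (allMaps (suc N)) fixedTerm + listSum (allMaps (suc N)) (λ π → openingTerm π + sumTo R (closingTerm π) h)
        ≈⟨ +-cong (fixedPointCase N j) (trans (listSum-distrib-+ (allMaps (suc N)) _ _)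
                                              (+-congˡ (listSum-sumTo (allMaps (suc N)) closingTerm h))) ⟩
      lSeq R x t q h * involSum N h + (involSum (suc N) (suc h) + sumTo R (closing N j) h) ∎
      where
      fixedTerm openingTerm : Vec (Fin (suc N)) (suc N) → Carrier
      fixedTerm π = if admissible h π ∧ ⌊ app π j ≟ j ⌋ then weight π else 0#
      openingTerm π = if admissible (suc h) π then weight π else 0#
      closingTerm : Vec (Fin (suc N)) (suc N) → ℕ → Carrier
      closingTerm π a = if admissible h π ∧ ⌊ toℕ (app π j) ℕₚ.≟ a ⌋ then weight π else 0#

  involSum-step′ : ∀ N h (j : Fin (suc N)) → toℕ j ≡ h →
    involSum (suc N) h ≈ lSeq R x t q h * involSum N h + (involSum (suc N) (suc h) + sumTo R (closing N j) h)
  involSum-step′ N _ j ≡.refl = Decomposition.involSum-step N j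

  involSum-empty : involSum 0 0 ≈ 1#
  involSum-empty rewrite admissible⁺ 0 [] (λ ()) (λ ()) =
    trans (+-identityʳ _) (trans (*-identityʳ _) (trans (*-identityʳ _) (*-identityʳ _)))

  involSum-full : ∀ h → involSum (suc h) (suc h) ≈ 0#
  involSum-full h = listSum-zero (allMaps (suc h)) not-admissible
    where
    not-admissible : ∀ π → (if admissible (suc h) π then weight π else 0#) ≈ 0#
    not-admissible π with admissible (suc h) π in adm
    ... | false = refl
    ... | true = ⊥-elim (ℕₚ.<⇒≱ (toℕ<n (app π Fin.zero)) (proj₂ (admissible⁻ (suc h) π adm) Fin.zero (s≤s z≤n)))

  involSum≈motzkin : ∀ n h → involSum (h ℕ.+ n) h ≈ MotzkinPaths.motzkin R (dSeq R v t q) (lSeq R x t q) n h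
  involSum≈motzkin zero zero = involSum-empty
  involSum≈motzkin zero (suc h) = trans (reflexive (cong (λ k → involSum k (suc h)) (ℕₚ.+-identityʳ (suc h)))) (involSum-full h)
  involSum≈motzkin (suc n) zero =
    trans (involSum-step′ n 0 Fin.zero ≡.refl)
          (+-cong (*-congˡ (involSum≈motzkin n 0)) (trans (+-identityʳ _) (involSum≈motzkin n 1)))
  involSum≈motzkin (suc n) (suc h) = begin
    involSum (suc h ℕ.+ suc n) (suc h)
      ≈⟨ reflexive (cong (λ k → involSum k (suc h)) (ℕₚ.+-suc (suc h) n)) ⟩
    involSum (suc (suc h ℕ.+ n)) (suc h)
      ≈⟨ involSum-step′ (suc h ℕ.+ n) (suc h) j toℕj≡1+h ⟩
    lSeq R x t q (suc h) * involSum (suc h ℕ.+ n) (suc h)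
      + (involSum (suc (suc h) ℕ.+ n) (suc (suc h)) + sumTo R (closing (suc h ℕ.+ n) j) (suc h))
      ≈⟨ +-cong (*-congˡ (involSum≈motzkin n (suc h)))
                (+-cong (involSum≈motzkin n (suc (suc h)))
                        (trans (closingSum (h ℕ.+ n) j h toℕj≡1+h) (*-congˡ (involSum≈motzkin n h)))) ⟩
    _ ≈⟨ +-assoc _ _ _ ⟨
    MotzkinPaths.motzkin R (dSeq R v t q) (lSeq R x t q) (suc n) (suc h) ∎
    where
    1+h<2+h+n : suc h < suc (suc h ℕ.+ n)
    1+h<2+h+n = s≤s (ℕₚ.m≤m+n (suc h) n)
    j : Fin (suc (suc h ℕ.+ n))
    j = fromℕ< 1+h<2+h+n
    toℕj≡1+h : toℕ j ≡ suc h
    toℕj≡1+h = toℕ-fromℕ< 1+h<2+h+n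

  involGF≈involSum : ∀ n → involGF R x v t q n ≈ involSum n 0
  involGF≈involSum n = listSum-cong (allMaps n) λ π → reflexive (cong (λ b → if b then weight π else 0#)
    (≡.sym (≡.trans (cong (isInvolution π ∧_) (⌊⌋-true (openPrefix? 0 (app π)) (λ _ ()))) (∧-identityʳ _))))

mainTheorem14 : ∀ {c ℓ} (R : CommutativeRing c ℓ) →
    let open CommutativeRing R in
    ∀ (x v t q : Carrier) (m n : ℕ) → n ≤ m →
    involGF R x v t q n ≈ cf R (dSeq R v t q) (lSeq R x t q) m 0 n
mainTheorem14 R x v t q m n n≤m = begin
  involGF R x v t q n                           ≈⟨ involGF≈involSum n ⟩
  involSum n 0                                  ≈⟨ involSum≈motzkin n 0 ⟩
  motzkin n 0                                   ≈⟨ motzkin≈cf m n n≤m ⟩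
  cf R (dSeq R v t q) (lSeq R x t q) m 0 n      ∎
  where
  open CommutativeRing R
  open import Relation.Binary.Reasoning.Setoid setoid
  open InvolutionSums R x v t q
  open MotzkinPaths R (dSeq R v t q) (lSeq R x t q)
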